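{- If a matroid $M$ is delta-graphic, then every (matroid) minor of $M$ is delta-graphic.
   Context: Graphs are finite and may have loops and parallel edges. A graft is a pair $(G,T)$ of a graph $G$ and a subset $T\subseteq V(G)$. A subgraph $H$ of $G$ is $T$-spanning if $V(H)=V(G)$ and every component $C$ of $H$ satisfies either (i) $|V(C)\cap T|$ is odd, or (ii) $V(C)\cap T=\emptyset$ and $G[V(C)]$ is a component of $G$. A set $F\subseteq E(G)$ is feasible in $(G,T)$ if it is the edge set of a $T$-spanning forest of $G$; let $\mathcal{F}(G,T)$ denote the set of feasible sets. For a family $\mathcal{F}$ of sets and a set $X$, write $\mathcal{F}\triangle X=\{F\triangle X: F\in\mathcal{F}\}$. A matroid $M$ is delta-graphic if there exist a graft $(G,T)$ with $E(G)=E(M)$ and a set $X\subseteq E(G)$ such that the set of bases of $M$ equals $\mathcal{F}(G,T)\triangle X$. -}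

module Defs where

open import Data.Nat using (ℕ; suc; _+_; _*_)
open import Data.Fin using (Fin)
open import Data.Fin.Subset using (Subset; _∈_; _∉_; _⊆_; _∩_; _∪_; _─_; ∁; ⊥; ∣_∣; ⁅_⁆)
open import Data.Product using (Σ; ∃; ∃-syntax; _×_; _,_)
open import Data.Sum using (_⊎_)
open import Relation.Binary.PropositionalEquality using (_≡_)
open import Relation.Nullary using (¬_)
open import Function.Bundles using (_⇔_)

-- Conventions: all element sets (edges / matroid elements) are subsets
-- of a fixed finite label universe Fin n.

Odd : ℕ → Set
Odd m = ∃[ k ] m ≡ suc (2 * k)

_△_ : ∀ {n} → Subset n → Subset n → Subset n
A △ B = (A ─ B) ∪ (B ─ A)

record Matroid (n : ℕ) : Set₁ where
  field
    E        : Subset n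
    IsBasis  : Subset n → Set
    basis⊆E  : ∀ {B} → IsBasis B → B ⊆ E
    nonempty : ∃[ B ] IsBasis B
    exchange : ∀ {B₁ B₂ x} → IsBasis B₁ → IsBasis B₂ → x ∈ B₁ → x ∉ B₂ →
               ∃[ y ] (y ∈ B₂ × y ∉ B₁ × IsBasis ((B₁ ─ ⁅ x ⁆) ∪ ⁅ y ⁆))

  Indep : Subset n → Set
  Indep I = ∃[ B ] (IsBasis B × I ⊆ B)

module _ {n : ℕ} (M : Matroid n) where
  open Matroid M

  MaxIndepIn : Subset n → Subset n → Set
  MaxIndepIn S J = J ⊆ S × Indep J × (∀ K → K ⊆ S → Indep K → J ⊆ K → K ≡ J)

  -- the minor M / C \ D, with ground set E − (C ∪ D)
  minorE : Subset n → Subset n → Subset n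
  minorE C D = E ─ (C ∪ D)

  minorIndep : Subset n → Subset n → Subset n → Set
  minorIndep C D I = I ⊆ minorE C D × ∃[ J ] (MaxIndepIn C J × Indep (I ∪ J))

  minorBasis : Subset n → Subset n → Subset n → Set
  minorBasis C D B = minorIndep C D B × (∀ I → minorIndep C D I → B ⊆ I → I ≡ B)

-- Graphs and grafts.  A graph with edge set E ⊆ Fin n on vertex set
-- Fin v is given by an endpoint map (only values on E are relevant);
-- loops and parallel edges are allowed.

record Graph (n : ℕ) : Set where
  field
    v    : ℕ
    ends : Fin n → Fin v × Fin v

module _ {n : ℕ} (G : Graph n) where
  open Graph G

  Incident : Fin n → Fin v → Fin v → Set
  Incident e a b = ends e ≡ (a , b) ⊎ ends e ≡ (b , a)

  data Reach (F : Subset n) (u : Fin v) : Fin v → Set where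
    here : Reach F u u
    step : ∀ {w x e} → Reach F u w → e ∈ F → Incident e w x → Reach F u x

  -- (V(G), F) is a forest: every edge of F is a bridge (lies on no cycle);
  -- in particular F contains no loops
  IsForest : Subset n → Set
  IsForest F = ∀ e a b → e ∈ F → ends e ≡ (a , b) → ¬ Reach (F ─ ⁅ e ⁆) a b

  Closed : Subset n → Subset v → Set
  Closed E S = ∀ e a b → e ∈ E → ends e ≡ (a , b) → (a ∈ S ⇔ b ∈ S)

  TSpanning : Subset n → Subset v → Subset n → Set
  TSpanning E T F = ∀ u → ∃[ S ] ((∀ w → (w ∈ S ⇔ Reach F u w)) ×
     (Odd ∣ S ∩ T ∣ ⊎ (S ∩ T ≡ ⊥ × Closed E S)))

  Feasible : Subset n → Subset v → Subset n → Set
  Feasible E T F = F ⊆ E × IsForest F × TSpanning E T F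

DeltaGraphic : ∀ {n} → Subset n → (Subset n → Set) → Set
DeltaGraphic {n} E Bases =
  Σ (Graph n) λ G → Σ (Subset (Graph.v G)) λ T → Σ (Subset n) λ X →
    X ⊆ E × (∀ Y → (Bases Y ⇔ (∃[ F ] (Feasible G E T F × Y ≡ F △ X))))

{-# OPTIONS --safe #-}
-- A delta-graphic set system is the family of feasible forests of a graft, twisted by a set X.
-- Deleting an element e (keeping the members avoiding e) or contracting it (keeping the members
-- through e, with e removed) preserves this: on feasible forests, deletion is realised by deleting
-- the edge e from the graft, and contraction by contracting e in G, which merges its ends a and b
-- and gives the merged vertex the parity of T ∩ {a, b}; twisting by X swaps the two operations at
-- the elements of X. The minor M / C ∖ D is reached by contracting a basis J of M | C element by
-- element and then deleting the rest of C and D element by element, where an element lying in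
-- every remaining basis (a coloop) is contracted instead, which has the same effect.
module Submission where

open import Defs
open import Data.Nat using (ℕ; zero; suc; _+_; _≤_; _<_; s≤s)
open import Data.Nat.Properties using (suc-injective; m≤m+n; ≤-<-trans; ≤-antisym; module ≤-Reasoning; +-mono-≤; +-suc; *-suc; +-identityʳ; +-cancelˡ-≡; n<1+n; <-≤-trans; <-irrefl; ≤-reflexive)
open import Data.Bool using (Bool; _≟_; true; false; _∧_; _∨_; not; _xor_)
open import Data.Bool.Properties using (∧-zeroʳ; ∧-identityʳ; ∨-identityʳ; ∧-distribˡ-xor; xor-comm; xor-assoc; xor-same; xor-identityʳ)
open import Data.Fin using (Fin; zero; suc)
open import Data.Fin.Properties using (any?; all?) renaming (_≟_ to _≟ᶠ_)
open import Data.Fin.Subset using (Subset; _∈_; _∉_; _⊆_; _∩_; _∪_; _─_; ⊥; ∣_∣; ⁅_⁆)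
open import Data.Fin.Subset.Properties
  using (x∈p∪q⁻; x∈p∪q⁺; p⊆p∪q; q⊆p∪q; x∈p∩q⁻; x∈p∩q⁺; p∩q⊆p; p∩q⊆q; ∩-comm; p⊆q⇒∣p∣≤∣q∣; x∈p∧x∉q⇒x∈p─q; x∈p∧x≢y⇒x∈p-y; p─q⊆p; x∈⁅x⁆; x∈⁅y⁆⇒x≡y; x≢y⇒x∉⁅y⁆; x∉⁅y⁆⇒x≢y; ∉⊥; ∣⊥∣≡0;
         ⊆-refl; ⊆-antisym; p─⊥≡p; p─q─r≡p─q∪r; p─q─r≡p─r─q; p⊂q⇒∣p∣<∣q∣; x∈p⇒∣p-x∣<∣p∣; _∈?_; _⊆?_; anySubset?)
open import Function using (_∘_; id)
open import Data.Vec using ([]; _∷_; lookup; tabulate)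
open import Data.Vec.Properties using (≡-dec; lookup-zipWith; lookup-replicate; lookup∘tabulate; tabulate∘lookup; tabulate-cong; []=⇒lookup; lookup⇒[]=)
open import Data.Unit using (tt)
open import Data.Product using (Σ; ∃; _×_; _,_; proj₁; proj₂)
open import Data.Product.Properties using (,-injective)
open import Data.Sum using (_⊎_; inj₁; inj₂; [_,_])
open import Data.Empty using (⊥-elim) renaming (⊥ to Empty)
open import Data.List using (List; []; _∷_; allFin)
open import Data.List.Relation.Unary.Any using (here; there)
open import Data.List.Membership.Propositional.Properties using (∈-allFin)
import Data.List.Membership.Propositional as List
open import Relation.Binary.PropositionalEquality hiding ([_])
open import Relation.Nullary using (¬_; Dec; yes; no; does)
open import Relation.Nullary.Decidable using (map′; _⊎-dec_; _×-dec_; _→-dec_; ¬?)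
open import Function.Bundles using (_⇔_; mk⇔; Equivalence)
open import Function.Properties.Equivalence using () renaming (trans to ⇔-trans; sym to ⇔-sym)

private variable
  n : ℕ

open Equivalence using (to; from)

∈⇒lookup : {p : Subset n} {x : Fin n} → x ∈ p → lookup p x ≡ true
∈⇒lookup = []=⇒lookup

lookup⇒∈ : {p : Subset n} {x : Fin n} → lookup p x ≡ true → x ∈ p
lookup⇒∈ {p = p} {x} = lookup⇒[]= x p

lookup⇒∉ : {p : Subset n} {x : Fin n} → lookup p x ≡ false → x ∉ p
lookup⇒∉ eq x∈p with trans (sym (∈⇒lookup x∈p)) eq
... | ()

∉⇒lookup : {p : Subset n} {x : Fin n} → x ∉ p → lookup p x ≡ false
∉⇒lookup {p = p} {x} x∉p with lookup p x in eq
... | true  = ⊥-elim (x∉p (lookup⇒∈ eq))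
... | false = refl

lookup-≡⇒∈⇔ : {p q : Subset n} {x y : Fin n} → lookup p x ≡ lookup q y → (x ∈ p ⇔ y ∈ q)
lookup-≡⇒∈⇔ eq = mk⇔ (λ m → lookup⇒∈ (trans (sym eq) (∈⇒lookup m)))
                     (λ m → lookup⇒∈ (trans eq (∈⇒lookup m)))

∈⇔⇒lookup-≡ : {p q : Subset n} {x y : Fin n} → (x ∈ p ⇔ y ∈ q) → lookup p x ≡ lookup q y
∈⇔⇒lookup-≡ {p = p} {q} {x} {y} x∈p⇔y∈q with lookup p x in ex | lookup q y in ey
... | true  | true  = refl
... | false | false = refl
... | true  | false = ⊥-elim (lookup⇒∉ ey (to x∈p⇔y∈q (lookup⇒∈ ex)))
... | false | true  = ⊥-elim (lookup⇒∉ ex (from x∈p⇔y∈q (lookup⇒∈ ey)))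

lookup-ext : {p q : Subset n} → (∀ i → lookup p i ≡ lookup q i) → p ≡ q
lookup-ext {p = p} {q} h = trans (sym (tabulate∘lookup p)) (trans (tabulate-cong h) (tabulate∘lookup q))

lookup-ext-at : {p q : Subset n} (e : Fin n) → lookup p e ≡ lookup q e →
                (∀ x → x ≢ e → lookup p x ≡ lookup q x) → p ≡ q
lookup-ext-at {p = p} {q} e at-e elsewhere = lookup-ext pointwise
  where
    pointwise : ∀ x → lookup p x ≡ lookup q x
    pointwise x with x ≟ᶠ e
    ... | yes refl = at-e
    ... | no x≢e   = elsewhere x x≢e

lookup-∪ : (p q : Subset n) (i : Fin n) → lookup (p ∪ q) i ≡ (lookup p i ∨ lookup q i)
lookup-∪ p q i = lookup-zipWith _∨_ i p q

lookup-∩ : (p q : Subset n) (i : Fin n) → lookup (p ∩ q) i ≡ (lookup p i ∧ lookup q i)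
lookup-∩ p q i = lookup-zipWith _∧_ i p q

lookup-─ : (p q : Subset n) (i : Fin n) → lookup (p ─ q) i ≡ (lookup p i ∧ not (lookup q i))
lookup-─ (x ∷ p) (true  ∷ q) zero    = sym (∧-zeroʳ x)
lookup-─ (x ∷ p) (false ∷ q) zero    = sym (∧-identityʳ x)
lookup-─ (_ ∷ p) (_     ∷ q) (suc i) = lookup-─ p q i

lookup-△ : (p q : Subset n) (i : Fin n) → lookup (p △ q) i ≡ (lookup p i xor lookup q i)
lookup-△ p q i rewrite lookup-∪ (p ─ q) (q ─ p) i | lookup-─ p q i | lookup-─ q p i
  with lookup p i | lookup q i
... | true  | true  = refl
... | true  | false = refl
... | false | true  = refl
... | false | false = refl

lookup-⊥ : (i : Fin n) → lookup (⊥ {n}) i ≡ false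
lookup-⊥ i = lookup-replicate i false

lookup-⁅x⁆-y : {x y : Fin n} → y ≢ x → lookup ⁅ x ⁆ y ≡ false
lookup-⁅x⁆-y y≢x = ∉⇒lookup (x≢y⇒x∉⁅y⁆ y≢x)

x∈p─q⁻ : {x : Fin n} (p q : Subset n) → x ∈ p ─ q → x ∈ p × x ∉ q
x∈p─q⁻ {x = x} p q x∈p─q with lookup p x in ep | lookup q x in eq | trans (sym (lookup-─ p q x)) (∈⇒lookup x∈p─q)
... | true | false | _ = lookup⇒∈ ep , lookup⇒∉ eq

∈∧∉⇒≢ : {x y : Fin n} {p : Subset n} → x ∈ p → y ∉ p → x ≢ y
∈∧∉⇒≢ x∈p y∉p refl = y∉p x∈p

lookup-∪⁅x⁆-x : (p : Subset n) (x : Fin n) → lookup (p ∪ ⁅ x ⁆) x ≡ true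
lookup-∪⁅x⁆-x p x = ∈⇒lookup (q⊆p∪q p ⁅ x ⁆ (x∈⁅x⁆ x))

lookup-∪⁅x⁆-y : (p : Subset n) {x y : Fin n} → y ≢ x → lookup (p ∪ ⁅ x ⁆) y ≡ lookup p y
lookup-∪⁅x⁆-y p {x} {y} y≢x =
  trans (lookup-∪ p ⁅ x ⁆ y) (trans (cong (lookup p y ∨_) (lookup-⁅x⁆-y y≢x)) (∨-identityʳ (lookup p y)))

lookup-─⁅x⁆-x : (p : Subset n) (x : Fin n) → lookup (p ─ ⁅ x ⁆) x ≡ false
lookup-─⁅x⁆-x p x = ∉⇒lookup (λ m → proj₂ (x∈p─q⁻ p ⁅ x ⁆ m) (x∈⁅x⁆ x))

lookup-─⁅x⁆-y : (p : Subset n) {x y : Fin n} → y ≢ x → lookup (p ─ ⁅ x ⁆) y ≡ lookup p y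
lookup-─⁅x⁆-y p {x} {y} y≢x rewrite lookup-─ p ⁅ x ⁆ y | lookup-⁅x⁆-y y≢x = ∧-identityʳ (lookup p y)

x∉p─x : (p : Subset n) (x : Fin n) → x ∉ p ─ ⁅ x ⁆
x∉p─x p x = lookup⇒∉ (lookup-─⁅x⁆-x p x)

p∪x─x≡p : {p : Subset n} {x : Fin n} → x ∉ p → (p ∪ ⁅ x ⁆) ─ ⁅ x ⁆ ≡ p
p∪x─x≡p {p = p} {x} x∉p = lookup-ext-at x
  (trans (lookup-─⁅x⁆-x (p ∪ ⁅ x ⁆) x) (sym (∉⇒lookup x∉p)))
  (λ z z≢x → trans (lookup-─⁅x⁆-y (p ∪ ⁅ x ⁆) z≢x) (lookup-∪⁅x⁆-y p z≢x))

p─x∪x≡p : {p : Subset n} {x : Fin n} → x ∈ p → (p ─ ⁅ x ⁆) ∪ ⁅ x ⁆ ≡ p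
p─x∪x≡p {p = p} {x} x∈p = lookup-ext-at x
  (trans (lookup-∪⁅x⁆-x (p ─ ⁅ x ⁆) x) (sym (∈⇒lookup x∈p)))
  (λ z z≢x → trans (lookup-∪⁅x⁆-y (p ─ ⁅ x ⁆) z≢x) (lookup-─⁅x⁆-y p z≢x))

p∪x─y≡p─y∪x : (p : Subset n) {x y : Fin n} → y ≢ x → (p ∪ ⁅ x ⁆) ─ ⁅ y ⁆ ≡ (p ─ ⁅ y ⁆) ∪ ⁅ x ⁆
p∪x─y≡p─y∪x p {x} {y} y≢x = lookup-ext-at x
  (trans (lookup-─⁅x⁆-y (p ∪ ⁅ x ⁆) (λ x≡y → y≢x (sym x≡y)))
         (trans (lookup-∪⁅x⁆-x p x) (sym (lookup-∪⁅x⁆-x (p ─ ⁅ y ⁆) x))))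
  (λ z z≢x → trans (lookup-─ (p ∪ ⁅ x ⁆) ⁅ y ⁆ z)
             (trans (cong (_∧ not (lookup ⁅ y ⁆ z)) (lookup-∪⁅x⁆-y p z≢x))
             (trans (sym (lookup-─ p ⁅ y ⁆ z)) (sym (lookup-∪⁅x⁆-y (p ─ ⁅ y ⁆) z≢x)))))

∪⁅x⁆-⊆ : {p q : Subset n} {x : Fin n} → p ⊆ q → x ∈ q → p ∪ ⁅ x ⁆ ⊆ q
∪⁅x⁆-⊆ {p = p} {x = x} p⊆q x∈q m with x∈p∪q⁻ p ⁅ x ⁆ m
... | inj₁ m′ = p⊆q m′
... | inj₂ m′ rewrite x∈⁅y⁆⇒x≡y x m′ = x∈q

─-monoˡ : {p p′ : Subset n} (q : Subset n) → p ⊆ p′ → p ─ q ⊆ p′ ─ q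
─-monoˡ {p = p} q p⊆p′ m = x∈p∧x∉q⇒x∈p─q (p⊆p′ (proj₁ (x∈p─q⁻ p q m))) (proj₂ (x∈p─q⁻ p q m))

⊆-∪-by : {I J K : Subset n} → (∀ {x} → x ∈ K → x ∉ J → x ∈ I) → K ⊆ I ∪ J
⊆-∪-by {I = I} {J} h {x} x∈K with x ∈? J
... | yes x∈J = q⊆p∪q I J x∈J
... | no  x∉J = p⊆p∪q J (h x∈K x∉J)

p∪q─q≡p : {p q : Subset n} → (∀ {x} → x ∈ p → x ∉ q) → (p ∪ q) ─ q ≡ p
p∪q─q≡p {p = p} {q} p∩q≡∅ = ⊆-antisym
  (λ m → let x∈p∪q , x∉q = x∈p─q⁻ (p ∪ q) q m in [ id , (λ x∈q → ⊥-elim (x∉q x∈q)) ] (x∈p∪q⁻ p q x∈p∪q))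
  (λ m → x∈p∧x∉q⇒x∈p─q (p⊆p∪q q m) (p∩q≡∅ m))

∩-⊥-⊆ : {R S T : Subset n} → R ⊆ S → S ∩ T ≡ ⊥ → R ∩ T ≡ ⊥
∩-⊥-⊆ {R = R} {S} {T} R⊆S S∩T≡⊥ = ⊆-antisym
  (λ {x} m → let x∈R , x∈T = x∈p∩q⁻ R T m in subst (x ∈_) S∩T≡⊥ (x∈p∩q⁺ (R⊆S x∈R , x∈T)))
  (λ m → ⊥-elim (∉⊥ m))

△-comm : (p q : Subset n) → p △ q ≡ q △ p
△-comm p q = lookup-ext λ i → trans (lookup-△ p q i) (trans (xor-comm (lookup p i) _) (sym (lookup-△ q p i)))

△-involutiveʳ : (p q : Subset n) → (p △ q) △ q ≡ p
△-involutiveʳ p q = lookup-ext λ i → begin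
  lookup ((p △ q) △ q) i                  ≡⟨ lookup-△ (p △ q) q i ⟩
  lookup (p △ q) i xor lookup q i         ≡⟨ cong (_xor lookup q i) (lookup-△ p q i) ⟩
  (lookup p i xor lookup q i) xor lookup q i ≡⟨ xor-assoc (lookup p i) _ _ ⟩
  lookup p i xor (lookup q i xor lookup q i) ≡⟨ cong (lookup p i xor_) (xor-same (lookup q i)) ⟩
  lookup p i xor false                    ≡⟨ xor-identityʳ (lookup p i) ⟩
  lookup p i                              ∎
  where open ≡-Reasoning

module _ {x : Fin n} {p q : Subset n} (x∉p : x ∉ p) (x∉q : x ∉ q) where

  ∉-△ : x ∉ p △ q
  ∉-△ = lookup⇒∉ (trans (lookup-△ p q x) (cong₂ _xor_ (∉⇒lookup x∉p) (∉⇒lookup x∉q)))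

  ∪⁅x⁆-△ : (p ∪ ⁅ x ⁆) △ q ≡ (p △ q) ∪ ⁅ x ⁆
  ∪⁅x⁆-△ = lookup-ext-at x
    (begin
      lookup ((p ∪ ⁅ x ⁆) △ q) x          ≡⟨ lookup-△ (p ∪ ⁅ x ⁆) q x ⟩
      lookup (p ∪ ⁅ x ⁆) x xor lookup q x ≡⟨ cong₂ _xor_ (lookup-∪⁅x⁆-x p x) (∉⇒lookup x∉q) ⟩
      true                               ≡⟨ sym (lookup-∪⁅x⁆-x (p △ q) x) ⟩
      lookup ((p △ q) ∪ ⁅ x ⁆) x          ∎)
    (λ y y≢x → begin
      lookup ((p ∪ ⁅ x ⁆) △ q) y          ≡⟨ lookup-△ (p ∪ ⁅ x ⁆) q y ⟩
      lookup (p ∪ ⁅ x ⁆) y xor lookup q y ≡⟨ cong (_xor lookup q y) (lookup-∪⁅x⁆-y p y≢x) ⟩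
      lookup p y xor lookup q y           ≡⟨ sym (lookup-△ p q y) ⟩
      lookup (p △ q) y                    ≡⟨ sym (lookup-∪⁅x⁆-y (p △ q) y≢x) ⟩
      lookup ((p △ q) ∪ ⁅ x ⁆) y          ∎)
    where open ≡-Reasoning

  ∪⁅x⁆-△-∪⁅x⁆ : (p ∪ ⁅ x ⁆) △ (q ∪ ⁅ x ⁆) ≡ p △ q
  ∪⁅x⁆-△-∪⁅x⁆ = lookup-ext-at x
    (trans (lookup-△ (p ∪ ⁅ x ⁆) (q ∪ ⁅ x ⁆) x)
      (trans (cong₂ _xor_ (lookup-∪⁅x⁆-x p x) (lookup-∪⁅x⁆-x q x)) (sym (∉⇒lookup ∉-△))))
    (λ y y≢x → trans (lookup-△ (p ∪ ⁅ x ⁆) (q ∪ ⁅ x ⁆) y)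
      (trans (cong₂ _xor_ (lookup-∪⁅x⁆-y p y≢x) (lookup-∪⁅x⁆-y q y≢x)) (sym (lookup-△ p q y))))

∪⁅x⁆-injective : {x : Fin n} {p q : Subset n} → x ∉ p → x ∉ q → p ∪ ⁅ x ⁆ ≡ q ∪ ⁅ x ⁆ → p ≡ q
∪⁅x⁆-injective x∉p x∉q eq = trans (sym (p∪x─x≡p x∉p)) (trans (cong (_─ ⁅ _ ⁆) eq) (p∪x─x≡p x∉q))

x∈p△q⁺ˡ : {x : Fin n} {p q : Subset n} → x ∈ p → x ∉ q → x ∈ p △ q
x∈p△q⁺ˡ x∈p x∉q = x∈p∪q⁺ (inj₁ (x∈p∧x∉q⇒x∈p─q x∈p x∉q))

x∈p△q⁺ʳ : {x : Fin n} {p q : Subset n} → x ∉ p → x ∈ q → x ∈ p △ q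
x∈p△q⁺ʳ x∉p x∈q = x∈p∪q⁺ (inj₂ (x∈p∧x∉q⇒x∈p─q x∈q x∉p))

x∈p∧x∈q⇒x∉p△q : {x : Fin n} {p q : Subset n} → x ∈ p → x ∈ q → x ∉ p △ q
x∈p∧x∈q⇒x∉p△q {p = p} {q} x∈p x∈q m with x∈p∪q⁻ (p ─ q) (q ─ p) m
... | inj₁ m′ = proj₂ (x∈p─q⁻ p q m′) x∈q
... | inj₂ m′ = proj₂ (x∈p─q⁻ q p m′) x∈p

module _ (S : Subset n) {P : Subset n → Set} {Ok : Subset n → Fin n → Set} (ok? : ∀ A x → Dec (Ok A x))
         (grow : ∀ {A x} → A ⊆ S → x ∈ S → x ∉ A → Ok A x → P A → P (A ∪ ⁅ x ⁆)) where

  Saturated : Subset n → Set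
  Saturated A = ∀ x → x ∈ S → x ∉ A → ¬ Ok A x

  private
    saturate′ : ∀ k {A} → ∣ S ─ A ∣ < k → A ⊆ S → P A → ∃ λ B → A ⊆ B × B ⊆ S × P B × Saturated B
    saturate′ (suc k) {A} (s≤s lt) A⊆S pA with any? (λ x → (x ∈? S) ×-dec ¬? (x ∈? A) ×-dec ok? A x)
    ... | no ∄ = A , ⊆-refl , A⊆S , pA , λ x x∈S x∉A ok → ∄ (x , x∈S , x∉A , ok)
    ... | yes (x , x∈S , x∉A , ok) with saturate′ k smaller (∪⁅x⁆-⊆ A⊆S x∈S) (grow A⊆S x∈S x∉A ok pA)
      where
        smaller : ∣ S ─ (A ∪ ⁅ x ⁆) ∣ < k
        smaller = <-≤-trans (subst (λ Z → ∣ Z ∣ < ∣ S ─ A ∣) (p─q─r≡p─q∪r S A ⁅ x ⁆)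
                              (x∈p⇒∣p-x∣<∣p∣ (x∈p∧x∉q⇒x∈p─q x∈S x∉A))) lt
    ... | B , A∪x⊆B , rest = B , (λ m → A∪x⊆B (p⊆p∪q ⁅ x ⁆ m)) , rest

  saturate : ∀ {A} → A ⊆ S → P A → ∃ λ B → A ⊆ B × B ⊆ S × P B × Saturated B
  saturate {A} = saturate′ (suc ∣ S ─ A ∣) (n<1+n _)

subset-induction : (Q : Subset n) (P : Subset n → Set) → P ⊥ →
                   (∀ {A x} → A ⊆ Q → x ∈ Q → x ∉ A → P A → P (A ∪ ⁅ x ⁆)) → P Q
subset-induction Q P p⊥ add with saturate Q (λ _ _ → yes tt) (λ A⊆Q x∈Q x∉A _ → add A⊆Q x∈Q x∉A) (λ m → ⊥-elim (∉⊥ m)) p⊥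
... | B , _ , B⊆Q , pB , saturated = subst P (⊆-antisym B⊆Q Q⊆B) pB
  where
    Q⊆B : Q ⊆ B
    Q⊆B {x} x∈Q with x ∈? B
    ... | yes x∈B = x∈B
    ... | no  x∉B = ⊥-elim (saturated x x∈Q x∉B tt)

𝟙 : Bool → ℕ
𝟙 true  = 1
𝟙 false = 0

∣p∣≡𝟙+∣p-x∣ : (x : Fin n) (p : Subset n) → ∣ p ∣ ≡ 𝟙 (lookup p x) + ∣ p ─ ⁅ x ⁆ ∣
∣p∣≡𝟙+∣p-x∣ zero    (true  ∷ p) = cong (suc ∘ ∣_∣) (sym (p─⊥≡p p))
∣p∣≡𝟙+∣p-x∣ zero    (false ∷ p) = cong ∣_∣ (sym (p─⊥≡p p))
∣p∣≡𝟙+∣p-x∣ (suc x) (true  ∷ p) = trans (cong suc (∣p∣≡𝟙+∣p-x∣ x p)) (sym (+-suc (𝟙 (lookup p x)) _))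
∣p∣≡𝟙+∣p-x∣ (suc x) (false ∷ p) = ∣p∣≡𝟙+∣p-x∣ x p

∣p∣≡∣p∩q∣+∣p─q∣ : (p q : Subset n) → ∣ p ∣ ≡ ∣ p ∩ q ∣ + ∣ p ─ q ∣
∣p∣≡∣p∩q∣+∣p─q∣ []          []          = refl
∣p∣≡∣p∩q∣+∣p─q∣ (true  ∷ p) (true  ∷ q) = cong suc (∣p∣≡∣p∩q∣+∣p─q∣ p q)
∣p∣≡∣p∩q∣+∣p─q∣ (true  ∷ p) (false ∷ q) = trans (cong suc (∣p∣≡∣p∩q∣+∣p─q∣ p q)) (sym (+-suc ∣ p ∩ q ∣ ∣ p ─ q ∣))
∣p∣≡∣p∩q∣+∣p─q∣ (false ∷ p) (true  ∷ q) = ∣p∣≡∣p∩q∣+∣p─q∣ p q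
∣p∣≡∣p∩q∣+∣p─q∣ (false ∷ p) (false ∷ q) = ∣p∣≡∣p∩q∣+∣p─q∣ p q

∣p∪q∣+∣p∩q∣≡∣p∣+∣q∣ : (p q : Subset n) → ∣ p ∪ q ∣ + ∣ p ∩ q ∣ ≡ ∣ p ∣ + ∣ q ∣
∣p∪q∣+∣p∩q∣≡∣p∣+∣q∣ []          []          = refl
∣p∪q∣+∣p∩q∣≡∣p∣+∣q∣ (true  ∷ p) (true  ∷ q) =
  cong suc (trans (+-suc ∣ p ∪ q ∣ ∣ p ∩ q ∣) (trans (cong suc (∣p∪q∣+∣p∩q∣≡∣p∣+∣q∣ p q)) (sym (+-suc ∣ p ∣ ∣ q ∣))))
∣p∪q∣+∣p∩q∣≡∣p∣+∣q∣ (true  ∷ p) (false ∷ q) = cong suc (∣p∪q∣+∣p∩q∣≡∣p∣+∣q∣ p q)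
∣p∪q∣+∣p∩q∣≡∣p∣+∣q∣ (false ∷ p) (true  ∷ q) = trans (cong suc (∣p∪q∣+∣p∩q∣≡∣p∣+∣q∣ p q)) (sym (+-suc ∣ p ∣ ∣ q ∣))
∣p∪q∣+∣p∩q∣≡∣p∣+∣q∣ (false ∷ p) (false ∷ q) = ∣p∪q∣+∣p∩q∣≡∣p∣+∣q∣ p q

∣p─x∪y∣≡∣p∣ : {p : Subset n} {x y : Fin n} → x ∈ p → y ∉ p → ∣ (p ─ ⁅ x ⁆) ∪ ⁅ y ⁆ ∣ ≡ ∣ p ∣
∣p─x∪y∣≡∣p∣ {p = p} {x} {y} x∈p y∉p = begin
  ∣ (p ─ ⁅ x ⁆) ∪ ⁅ y ⁆ ∣                                       ≡⟨ ∣p∣≡𝟙+∣p-x∣ y ((p ─ ⁅ x ⁆) ∪ ⁅ y ⁆) ⟩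
  𝟙 (lookup ((p ─ ⁅ x ⁆) ∪ ⁅ y ⁆) y) + ∣ ((p ─ ⁅ x ⁆) ∪ ⁅ y ⁆) ─ ⁅ y ⁆ ∣ ≡⟨ cong₂ (λ b r → 𝟙 b + ∣ r ∣) (lookup-∪⁅x⁆-x (p ─ ⁅ x ⁆) y) (p∪x─x≡p y∉p─x) ⟩
  𝟙 true + ∣ p ─ ⁅ x ⁆ ∣                                        ≡⟨ cong (λ b → 𝟙 b + ∣ p ─ ⁅ x ⁆ ∣) (sym (∈⇒lookup x∈p)) ⟩
  𝟙 (lookup p x) + ∣ p ─ ⁅ x ⁆ ∣                                ≡⟨ sym (∣p∣≡𝟙+∣p-x∣ x p) ⟩
  ∣ p ∣                                                        ∎
  where
    open ≡-Reasoning
    y∉p─x : y ∉ p ─ ⁅ x ⁆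
    y∉p─x m = y∉p (p─q⊆p p ⁅ x ⁆ m)

⊆∧∣∣≤⇒≡ : {p q : Subset n} → p ⊆ q → ∣ q ∣ ≤ ∣ p ∣ → p ≡ q
⊆∧∣∣≤⇒≡ {p = p} {q} p⊆q ∣q∣≤∣p∣ = ⊆-antisym p⊆q q⊆p
  where
    q⊆p : q ⊆ p
    q⊆p {x} x∈q with x ∈? p
    ... | yes x∈p = x∈p
    ... | no  x∉p = ⊥-elim (<-irrefl refl (<-≤-trans (p⊂q⇒∣p∣<∣q∣ (p⊆q , x , x∈q , x∉p)) ∣q∣≤∣p∣))

module TwoPoints {a b : Fin n} (a≢b : a ≢ b) where

  rest : Subset n → Subset n
  rest X = X ─ ⁅ a ⁆ ─ ⁅ b ⁆

  lookup-rest : (X : Subset n) {x : Fin n} → x ≢ a → x ≢ b → lookup (rest X) x ≡ lookup X x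
  lookup-rest X x≢a x≢b = trans (lookup-─⁅x⁆-y (X ─ ⁅ a ⁆) x≢b) (lookup-─⁅x⁆-y X x≢a)

  lookup-rest-a : (X : Subset n) → lookup (rest X) a ≡ false
  lookup-rest-a X = trans (lookup-─ (X ─ ⁅ a ⁆) ⁅ b ⁆ a) (cong (_∧ _) (lookup-─⁅x⁆-x X a))

  lookup-rest-b : (X : Subset n) → lookup (rest X) b ≡ false
  lookup-rest-b X = lookup-─⁅x⁆-x (X ─ ⁅ a ⁆) b

  rest-cong : {X Y : Subset n} → (∀ x → x ≢ a → x ≢ b → lookup X x ≡ lookup Y x) → rest X ≡ rest Y
  rest-cong {X} {Y} h = lookup-ext pointwise
    where
      pointwise : ∀ x → lookup (rest X) x ≡ lookup (rest Y) x
      pointwise x with x ≟ᶠ a | x ≟ᶠ b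
      ... | yes refl | _        = trans (lookup-rest-a X) (sym (lookup-rest-a Y))
      ... | no _     | yes refl = trans (lookup-rest-b X) (sym (lookup-rest-b Y))
      ... | no x≢a   | no x≢b   = trans (lookup-rest X x≢a x≢b) (trans (h x x≢a x≢b) (sym (lookup-rest Y x≢a x≢b)))

  rest-⊥ : rest ⊥ ≡ ⊥
  rest-⊥ = ⊆-antisym (λ m → p─q⊆p ⊥ ⁅ a ⁆ (p─q⊆p _ ⁅ b ⁆ m)) (λ m → ⊥-elim (∉⊥ m))

  ≡⊥-by-points : (X : Subset n) → lookup X a ≡ false → lookup X b ≡ false → rest X ≡ ⊥ → X ≡ ⊥
  ≡⊥-by-points X Xa Xb rest≡⊥ = lookup-ext pointwise
    where
      pointwise : ∀ x → lookup X x ≡ lookup ⊥ x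
      pointwise x with x ≟ᶠ a | x ≟ᶠ b
      ... | yes refl | _        = trans Xa (sym (lookup-⊥ x))
      ... | no _     | yes refl = trans Xb (sym (lookup-⊥ x))
      ... | no x≢a   | no x≢b   = trans (sym (lookup-rest X x≢a x≢b)) (cong (λ Z → lookup Z x) rest≡⊥)

  ∣∣≡𝟙+𝟙+∣rest∣ : (X : Subset n) → ∣ X ∣ ≡ 𝟙 (lookup X a) + (𝟙 (lookup X b) + ∣ rest X ∣)
  ∣∣≡𝟙+𝟙+∣rest∣ X = trans (∣p∣≡𝟙+∣p-x∣ a X) (cong (𝟙 (lookup X a) +_)
    (trans (∣p∣≡𝟙+∣p-x∣ b (X ─ ⁅ a ⁆)) (cong (λ t → 𝟙 t + ∣ rest X ∣) (lookup-─⁅x⁆-y X (λ b≡a → a≢b (sym b≡a))))))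

¬odd-0 : ¬ Odd 0
¬odd-0 (_ , ())

odd⇔odd-2+ : ∀ m → Odd m ⇔ Odd (2 + m)
odd⇔odd-2+ m = mk⇔ (λ { (k , refl) → suc k , cong suc (sym (*-suc 2 k)) }) from-2+
  where
    from-2+ : Odd (2 + m) → Odd m
    from-2+ (suc k , eq) = k , suc-injective (trans (suc-injective eq) (*-suc 2 k))

odd-𝟙+𝟙⇔odd-𝟙-xor : ∀ x y r → Odd (𝟙 x + (𝟙 y + r)) ⇔ Odd (𝟙 (x xor y) + r)
odd-𝟙+𝟙⇔odd-𝟙-xor true  true  r = ⇔-sym (odd⇔odd-2+ r)
odd-𝟙+𝟙⇔odd-𝟙-xor true  false r = mk⇔ id id
odd-𝟙+𝟙⇔odd-𝟙-xor false true  r = mk⇔ id id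
odd-𝟙+𝟙⇔odd-𝟙-xor false false r = mk⇔ id id

odd? : ∀ m → Dec (Odd m)
odd? zero          = no ¬odd-0
odd? (suc zero)    = yes (0 , refl)
odd? (suc (suc m)) = map′ (to (odd⇔odd-2+ m)) (from (odd⇔odd-2+ m)) (odd? m)

¬odd-∣⊥∣ : ¬ Odd ∣ ⊥ {n} ∣
¬odd-∣⊥∣ {n} o = ¬odd-0 (subst Odd (∣⊥∣≡0 n) o)

-- Reachability and forests

module Reachability {n : ℕ} (G : Graph n) where
  open Graph G

  TComponent : Subset n → Subset v → Subset v → Set
  TComponent E T S = Odd ∣ S ∩ T ∣ ⊎ (S ∩ T ≡ ⊥ × Closed G E S)

  TSpanningAt : Subset n → Subset v → Subset n → Fin v → Set
  TSpanningAt E T F u = ∃ λ S → (∀ w → w ∈ S ⇔ Reach G F u w) × TComponent E T S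

  incident-sym : ∀ {e a b} → Incident G e a b → Incident G e b a
  incident-sym (inj₁ eq) = inj₂ eq
  incident-sym (inj₂ eq) = inj₁ eq

  reach-trans : ∀ {F u w x} → Reach G F u w → Reach G F w x → Reach G F u x
  reach-trans p here         = p
  reach-trans p (step q m i) = step (reach-trans p q) m i

  reach-edge : ∀ {F e w x} → e ∈ F → Incident G e w x → Reach G F w x
  reach-edge = step here

  reach-sym : ∀ {F u w} → Reach G F u w → Reach G F w u
  reach-sym here         = here
  reach-sym (step p m i) = reach-trans (reach-edge m (incident-sym i)) (reach-sym p)

  reach-mono : ∀ {F F′ u w} → F ⊆ F′ → Reach G F u w → Reach G F′ u w
  reach-mono F⊆F′ here         = here
  reach-mono F⊆F′ (step p m i) = step (reach-mono F⊆F′ p) (F⊆F′ m) i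

  reach-⊥ : ∀ {u w} → Reach G ⊥ u w → u ≡ w
  reach-⊥ here         = refl
  reach-⊥ (step _ m _) = ⊥-elim (∉⊥ m)

  -- A walk using the extra edge cd may be assumed to use it at most once.
  ReachThrough : Subset n → Fin v → Fin v → Fin v → Fin v → Set
  ReachThrough A c d x y = Reach G A x y ⊎ (Reach G A x c × Reach G A d y) ⊎ (Reach G A x d × Reach G A c y)

  private
    through-step : ∀ {A c d x w z g} → g ∈ A → Incident G g w z → ReachThrough A c d x w → ReachThrough A c d x z
    through-step m i (inj₁ p)              = inj₁ (step p m i)
    through-step m i (inj₂ (inj₁ (p , q))) = inj₂ (inj₁ (p , step q m i))
    through-step m i (inj₂ (inj₂ (p , q))) = inj₂ (inj₂ (p , step q m i))

    through-cd : ∀ {A c d x w z} → (c , d) ≡ (w , z) ⊎ (c , d) ≡ (z , w) → ReachThrough A c d x w → ReachThrough A c d x z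
    through-cd (inj₁ refl) (inj₁ p)              = inj₂ (inj₁ (p , here))
    through-cd (inj₂ refl) (inj₁ p)              = inj₂ (inj₂ (p , here))
    through-cd (inj₁ refl) (inj₂ (inj₁ (p , _))) = inj₂ (inj₁ (p , here))
    through-cd (inj₂ refl) (inj₂ (inj₁ (p , _))) = inj₁ p
    through-cd (inj₁ refl) (inj₂ (inj₂ (p , _))) = inj₁ p
    through-cd (inj₂ refl) (inj₂ (inj₂ (p , _))) = inj₂ (inj₂ (p , here))

  incident-ends : ∀ {f c d w z} → ends f ≡ (c , d) → Incident G f w z → (c , d) ≡ (w , z) ⊎ (c , d) ≡ (z , w)
  incident-ends hf (inj₁ eq) = inj₁ (trans (sym hf) eq)
  incident-ends hf (inj₂ eq) = inj₂ (trans (sym hf) eq)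

  reach-∪⁅f⁆⁻ : ∀ {A f c d x y} → ends f ≡ (c , d) → Reach G (A ∪ ⁅ f ⁆) x y → ReachThrough A c d x y
  reach-∪⁅f⁆⁻ hf here = inj₁ here
  reach-∪⁅f⁆⁻ {A} {f} hf (step p m i) with x∈p∪q⁻ A ⁅ f ⁆ m
  ... | inj₁ g∈A = through-step g∈A i (reach-∪⁅f⁆⁻ hf p)
  ... | inj₂ g∈f with x∈⁅y⁆⇒x≡y f g∈f
  ... | refl = through-cd (incident-ends hf i) (reach-∪⁅f⁆⁻ hf p)

  reach-∪⁅f⁆⁺ : ∀ {A f c d x y} → ends f ≡ (c , d) → ReachThrough A c d x y → Reach G (A ∪ ⁅ f ⁆) x y
  reach-∪⁅f⁆⁺ {A} {f} hf (inj₁ p) = reach-mono (p⊆p∪q ⁅ f ⁆) p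
  reach-∪⁅f⁆⁺ {A} {f} hf (inj₂ (inj₁ (p , q))) =
    reach-trans (reach-mono (p⊆p∪q ⁅ f ⁆) p)
      (reach-trans (reach-edge (q⊆p∪q A ⁅ f ⁆ (x∈⁅x⁆ f)) (inj₁ hf)) (reach-mono (p⊆p∪q ⁅ f ⁆) q))
  reach-∪⁅f⁆⁺ {A} {f} hf (inj₂ (inj₂ (p , q))) =
    reach-trans (reach-mono (p⊆p∪q ⁅ f ⁆) p)
      (reach-trans (reach-edge (q⊆p∪q A ⁅ f ⁆ (x∈⁅x⁆ f)) (inj₂ hf)) (reach-mono (p⊆p∪q ⁅ f ⁆) q))

  private
    restrict : Subset n → List (Fin n) → Subset n
    restrict F []       = ⊥
    restrict F (e ∷ es) with e ∈? F
    ... | yes _ = restrict F es ∪ ⁅ e ⁆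
    ... | no  _ = restrict F es

    restrict-⊆ : ∀ F es → restrict F es ⊆ F
    restrict-⊆ F []       m = ⊥-elim (∉⊥ m)
    restrict-⊆ F (e ∷ es) m with e ∈? F
    ... | no  _ = restrict-⊆ F es m
    ... | yes e∈F with x∈p∪q⁻ (restrict F es) ⁅ e ⁆ m
    ... | inj₁ m′ = restrict-⊆ F es m′
    ... | inj₂ m′ rewrite x∈⁅y⁆⇒x≡y e m′ = e∈F

    restrict-⊇ : ∀ F es {x} → x List.∈ es → x ∈ F → x ∈ restrict F es
    restrict-⊇ F (e ∷ es) (here refl) x∈F with e ∈? F
    ... | yes _  = q⊆p∪q (restrict F es) ⁅ e ⁆ (x∈⁅x⁆ e)
    ... | no e∉F = ⊥-elim (e∉F x∈F)
    restrict-⊇ F (e ∷ es) (there x∈es) x∈F with e ∈? F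
    ... | yes _ = p⊆p∪q ⁅ e ⁆ (restrict-⊇ F es x∈es x∈F)
    ... | no  _ = restrict-⊇ F es x∈es x∈F

    restrict-allFin : ∀ F → restrict F (allFin n) ≡ F
    restrict-allFin F = ⊆-antisym (restrict-⊆ F (allFin n)) (λ {x} → restrict-⊇ F (allFin n) (∈-allFin x))

    reach-restrict? : ∀ F es u w → Dec (Reach G (restrict F es) u w)
    reach-restrict? F [] u w with u ≟ᶠ w
    ... | yes refl = yes here
    ... | no u≢w   = no (λ r → u≢w (reach-⊥ r))
    reach-restrict? F (e ∷ es) u w with e ∈? F
    ... | no  _ = reach-restrict? F es u w
    ... | yes _ = map′ (reach-∪⁅f⁆⁺ refl) (reach-∪⁅f⁆⁻ refl)
      (reach-restrict? F es u w
        ⊎-dec (reach-restrict? F es u c ×-dec reach-restrict? F es d w)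
        ⊎-dec (reach-restrict? F es u d ×-dec reach-restrict? F es c w))
      where c = proj₁ (ends e)
            d = proj₂ (ends e)

  reach? : ∀ F u w → Dec (Reach G F u w)
  reach? F u w = subst (λ F′ → Dec (Reach G F′ u w)) (restrict-allFin F) (reach-restrict? F (allFin n) u w)

  closed-reach : ∀ {E S F u w} → Closed G E S → F ⊆ E → u ∈ S → Reach G F u w → w ∈ S
  closed-reach cl F⊆E u∈S here                 = u∈S
  closed-reach cl F⊆E u∈S (step r m (inj₁ eq)) = to   (cl _ _ _ (F⊆E m) eq) (closed-reach cl F⊆E u∈S r)
  closed-reach cl F⊆E u∈S (step r m (inj₂ eq)) = from (cl _ _ _ (F⊆E m) eq) (closed-reach cl F⊆E u∈S r)

  LastEdge : Subset n → Fin v → Fin v → Set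
  LastEdge F x y = ∃ λ f → ∃ λ w → f ∈ F × Incident G f w y × Reach G (F ─ ⁅ f ⁆) x w

  -- A walk whose prefix already uses its last edge f is shortcut to a shorter walk in F ─ ⁅ f ⁆.
  reach⇒lastEdge : ∀ k F {x y} → ∣ F ∣ < k → Reach G F x y → x ≢ y → LastEdge F x y
  reach⇒lastEdge (suc k) F     lt here x≢y = ⊥-elim (x≢y refl)
  reach⇒lastEdge (suc k) F {x} {y} (s≤s lt) (step {w = w} {e = f} p f∈F i) x≢y =
    from-through (reach-∪⁅f⁆⁻ refl p′) (incident-ends refl i)
    where
      c = proj₁ (ends f)
      d = proj₂ (ends f)
      F-f = F ─ ⁅ f ⁆
      p′ : Reach G (F-f ∪ ⁅ f ⁆) x w
      p′ = subst (λ F′ → Reach G F′ x w) (sym (p─x∪x≡p f∈F)) p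
      shorter : Reach G F-f x y → LastEdge F x y
      shorter r with reach⇒lastEdge k F-f (<-≤-trans (x∈p⇒∣p-x∣<∣p∣ f∈F) lt) r x≢y
      ... | f′ , w′ , f′∈ , i′ , r′ =
        f′ , w′ , proj₁ (x∈p─q⁻ F ⁅ f ⁆ f′∈) , i′ , reach-mono (─-monoˡ ⁅ f′ ⁆ (p─q⊆p F ⁅ f ⁆)) r′
      last : ∀ {z} → z ≡ w → Reach G F-f x z → LastEdge F x y
      last refl r = f , w , f∈F , i , r
      from-through : ReachThrough F-f c d x w → (c , d) ≡ (w , y) ⊎ (c , d) ≡ (y , w) → LastEdge F x y
      from-through (inj₁ r)                 _        = f , w , f∈F , i , r
      from-through (inj₂ (inj₁ (xc , _))) (inj₁ refl) = last refl xc
      from-through (inj₂ (inj₁ (xc , _))) (inj₂ refl) = shorter xc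
      from-through (inj₂ (inj₂ (xd , _))) (inj₁ refl) = shorter xd
      from-through (inj₂ (inj₂ (xd , _))) (inj₂ refl) = last refl xd

  isForest-∪⁅e⁆ : ∀ {F e a b} → IsForest G F → e ∉ F → ends e ≡ (a , b) → ¬ Reach G F a b → IsForest G (F ∪ ⁅ e ⁆)
  isForest-∪⁅e⁆ {F} {e} fo e∉F he ¬ab g p q g∈ hg r with g ≟ᶠ e
  ... | yes refl with ,-injective (trans (sym hg) he)
  ... | refl , refl = ¬ab (subst (λ F′ → Reach G F′ p q) (p∪x─x≡p e∉F) r)
  isForest-∪⁅e⁆ {F} {e} fo e∉F he ¬ab g p q g∈ hg r | no g≢e with x∈p∪q⁻ F ⁅ e ⁆ g∈
  ... | inj₂ g∈e = g≢e (x∈⁅y⁆⇒x≡y e g∈e)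
  ... | inj₁ g∈F with reach-∪⁅f⁆⁻ he (subst (λ F′ → Reach G F′ p q) (p∪x─y≡p─y∪x F g≢e) r)
  ... | inj₁ r′                = fo g p q g∈F hg r′
  ... | inj₂ (inj₁ (pa , bq)) = ¬ab (reach-trans (reach-sym (weaken pa)) (reach-trans (reach-edge g∈F (inj₁ hg)) (reach-sym (weaken bq))))
    where weaken : ∀ {x y} → Reach G (F ─ ⁅ g ⁆) x y → Reach G F x y
          weaken = reach-mono (p─q⊆p F ⁅ g ⁆)
  ... | inj₂ (inj₂ (pb , aq)) = ¬ab (reach-trans (weaken aq) (reach-trans (reach-edge g∈F (inj₂ hg)) (weaken pb)))
    where weaken : ∀ {x y} → Reach G (F ─ ⁅ g ⁆) x y → Reach G F x y
          weaken = reach-mono (p─q⊆p F ⁅ g ⁆)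

  isForest⇒¬loop : ∀ {F e a b} → IsForest G F → e ∈ F → ends e ≡ (a , b) → a ≢ b
  isForest⇒¬loop fo e∈F he refl = fo _ _ _ e∈F he here

-- Decidability of feasibility

module FeasibleDecidable {n : ℕ} (G : Graph n) where
  open Graph G
  open Reachability G

  component : Subset n → Fin v → Subset v
  component F u = tabulate (λ w → does (reach? F u w))

  ∈component⇔ : ∀ {F u w} → w ∈ component F u ⇔ Reach G F u w
  ∈component⇔ {F} {u} {w} = mk⇔ ∈⇒reach reach⇒∈
    where
      lookup-component : lookup (component F u) w ≡ does (reach? F u w)
      lookup-component = lookup∘tabulate _ w
      ∈⇒reach : w ∈ component F u → Reach G F u w
      ∈⇒reach m with reach? F u w | lookup-component
      ... | yes r | _  = r
      ... | no _  | eq = ⊥-elim (lookup⇒∉ eq m)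
      reach⇒∈ : Reach G F u w → w ∈ component F u
      reach⇒∈ r with reach? F u w | lookup-component
      ... | yes _ | eq = lookup⇒∈ eq
      ... | no ¬r | _  = ⊥-elim (¬r r)

  component-unique : ∀ {F u} S → (∀ w → w ∈ S ⇔ Reach G F u w) → S ≡ component F u
  component-unique S h = ⊆-antisym (λ {w} m → from ∈component⇔ (to (h w) m))
                                   (λ {w} m → from (h w) (to ∈component⇔ m))

  private
    _⇔?_ : ∀ {A B : Set} → Dec A → Dec B → Dec (A ⇔ B)
    a? ⇔? b? = map′ (λ (f , g) → mk⇔ f g) (λ a⇔b → to a⇔b , from a⇔b) ((a? →-dec b?) ×-dec (b? →-dec a?))

  closed? : ∀ E S → Dec (Closed G E S)
  closed? E S = map′ (λ c g a b g∈E hg → subst (λ (a′ , b′) → a′ ∈ S ⇔ b′ ∈ S) hg (c g g∈E))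
                     (λ c g g∈E → c g _ _ g∈E refl)
    (all? (λ g → (g ∈? E) →-dec ((proj₁ (ends g) ∈? S) ⇔? (proj₂ (ends g) ∈? S))))

  tComponent? : ∀ E T S → Dec (TComponent E T S)
  tComponent? E T S = odd? ∣ S ∩ T ∣ ⊎-dec (≡-dec _≟_ (S ∩ T) ⊥ ×-dec closed? E S)

  tSpanning⇔ : ∀ {E T F} → TSpanning G E T F ⇔ (∀ u → TComponent E T (component F u))
  tSpanning⇔ {E} {T} {F} = mk⇔ canonical (λ c u → component F u , (λ w → ∈component⇔) , c u)
    where
      canonical : TSpanning G E T F → ∀ u → TComponent E T (component F u)
      canonical ts u with ts u
      ... | S , h , c = subst (TComponent E T) (component-unique S h) c

  isForest? : ∀ F → Dec (IsForest G F)
  isForest? F = map′ (λ h g a b g∈F hg → subst (λ (a′ , b′) → ¬ Reach G (F ─ ⁅ g ⁆) a′ b′) hg (h g g∈F))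
                     (λ fo g g∈F → fo g _ _ g∈F refl)
    (all? (λ g → (g ∈? F) →-dec ¬? (reach? (F ─ ⁅ g ⁆) (proj₁ (ends g)) (proj₂ (ends g)))))

  feasible? : ∀ E T F → Dec (Feasible G E T F)
  feasible? E T F = (F ⊆? E) ×-dec isForest? F ×-dec
    map′ (from tSpanning⇔) (to tSpanning⇔) (all? (λ u → tComponent? E T (component F u)))

-- Deleting an edge from a graft

module Deletion {n : ℕ} (G : Graph n) where
  open Graph G
  open Reachability G

  tSpanning-map : ∀ {E E′ T F} → (∀ S → S ∩ T ≡ ⊥ → Closed G E S → Closed G E′ S) →
                  TSpanning G E T F → TSpanning G E′ T F
  tSpanning-map f ts u with ts u
  ... | S , h , inj₁ odd            = S , h , inj₁ odd
  ... | S , h , inj₂ (S∩T≡⊥ , cl) = S , h , inj₂ (S∩T≡⊥ , f S S∩T≡⊥ cl)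

  closed-antitone : ∀ {E E′ S} → E′ ⊆ E → Closed G E S → Closed G E′ S
  closed-antitone E′⊆E cl g a b g∈E′ = cl g a b (E′⊆E g∈E′)

  -- The F₀-components inside a T-free set S are themselves T-free, hence closed in E.
  closed-without⇒closed : ∀ {E T F₀ S e} → Feasible G E T F₀ → e ∉ F₀ → S ∩ T ≡ ⊥ →
                          Closed G (E ─ ⁅ e ⁆) S → Closed G E S
  closed-without⇒closed {E} {T} {F₀} {S} {e} (F₀⊆E , _ , ts) e∉F₀ S∩T≡⊥ cl g a b g∈E hg with g ≟ᶠ e
  ... | no g≢e   = cl g a b (x∈p∧x∉q⇒x∈p─q g∈E (x≢y⇒x∉⁅y⁆ g≢e)) hg
  ... | yes refl = mk⇔ (λ a∈S → let R , a∈R , R⊆S , clR = enclosing a a∈S in R⊆S (to (clR g a b g∈E hg) a∈R))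
                       (λ b∈S → let R , b∈R , R⊆S , clR = enclosing b b∈S in R⊆S (from (clR g a b g∈E hg) b∈R))
    where
      enclosing : ∀ u → u ∈ S → ∃ λ R → u ∈ R × R ⊆ S × Closed G E R
      enclosing u u∈S with ts u
      ... | R , h , c = R , from (h u) here , R⊆S , closedR c
        where
          R⊆S : R ⊆ S
          R⊆S {w} m = closed-reach cl (λ f∈F₀ → x∈p∧x≢y⇒x∈p-y (F₀⊆E f∈F₀) (∈∧∉⇒≢ f∈F₀ e∉F₀)) u∈S (to (h w) m)
          closedR : TComponent E T R → Closed G E R
          closedR (inj₁ odd)      = ⊥-elim (¬odd-∣⊥∣ {v} (subst (λ X → Odd ∣ X ∣) (∩-⊥-⊆ R⊆S S∩T≡⊥) odd))
          closedR (inj₂ (_ , clR)) = clR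

  feasible-delete⇔ : ∀ {E T F₀ e} → Feasible G E T F₀ → e ∉ F₀ →
                     ∀ F → Feasible G (E ─ ⁅ e ⁆) T F ⇔ (Feasible G E T F × e ∉ F)
  feasible-delete⇔ {E} {T} {F₀} {e} feasible₀ e∉F₀ F = mk⇔
    (λ (F⊆ , fo , ts) → ((λ m → proj₁ (x∈p─q⁻ E ⁅ e ⁆ (F⊆ m))) , fo ,
                          tSpanning-map (λ S S∩T≡⊥ → closed-without⇒closed feasible₀ e∉F₀ S∩T≡⊥) ts)
                       , (λ e∈F → proj₂ (x∈p─q⁻ E ⁅ e ⁆ (F⊆ e∈F)) (x∈⁅x⁆ e)))
    (λ ((F⊆E , fo , ts) , e∉F) → (λ m → x∈p∧x≢y⇒x∈p-y (F⊆E m) (∈∧∉⇒≢ m e∉F)) , fo ,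
                                  tSpanning-map (λ _ _ → closed-antitone (p─q⊆p E ⁅ e ⁆)) ts)

-- Contracting an edge of a graft

-- G / e keeps the vertex set and redirects every end at b to a, so that b becomes
-- isolated; T is replaced by contractT T, which drops b and gives a the parity of T ∩ {a, b}.
module Contraction {n : ℕ} (G : Graph n) (e : Fin n) {a b : Fin (Graph.v G)}
                   (ends-e : Graph.ends G e ≡ (a , b)) (a≢b : a ≢ b) where
  open Graph G
  open Reachability G
  open TwoPoints a≢b

  private
    e∈F∪e : ∀ {F : Subset n} → e ∈ F ∪ ⁅ e ⁆
    e∈F∪e {F} = q⊆p∪q F ⁅ e ⁆ (x∈⁅x⁆ e)

    F⊆F∪e : ∀ {F : Subset n} → F ⊆ F ∪ ⁅ e ⁆
    F⊆F∪e = p⊆p∪q ⁅ e ⁆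

  merge : Fin v → Fin v
  merge x with x ≟ᶠ b
  ... | yes _ = a
  ... | no  _ = x

  merge-b : merge b ≡ a
  merge-b with b ≟ᶠ b
  ... | yes _   = refl
  ... | no b≢b = ⊥-elim (b≢b refl)

  merge-≢b : ∀ {x} → x ≢ b → merge x ≡ x
  merge-≢b {x} x≢b with x ≟ᶠ b
  ... | yes x≡b = ⊥-elim (x≢b x≡b)
  ... | no  _   = refl

  merge≢b : ∀ x → merge x ≢ b
  merge≢b x with x ≟ᶠ b
  ... | yes _   = a≢b
  ... | no x≢b = x≢b

  merge-ends : Fin v × Fin v → Fin v × Fin v
  merge-ends (x , y) = merge x , merge y

  G/e : Graph n
  G/e = record { v = v ; ends = merge-ends ∘ ends }

  module /e = Reachability G/e

  reach-merge : ∀ {F} y → Reach G (F ∪ ⁅ e ⁆) y (merge y)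
  reach-merge y with y ≟ᶠ b
  ... | yes refl = reach-sym (reach-edge e∈F∪e (inj₁ ends-e))
  ... | no  _    = here

  -- a step of G / e along g is a walk in G using g and possibly e
  reach-/e⇒reach : ∀ {F p q} → Reach G/e F p q → Reach G (F ∪ ⁅ e ⁆) p q
  reach-/e⇒reach here = here
  reach-/e⇒reach (step {e = g} r g∈F (inj₁ eq)) with ,-injective eq
  ... | refl , refl = reach-trans (reach-/e⇒reach r) (reach-trans (reach-sym (reach-merge (proj₁ (ends g))))
                        (reach-trans (reach-edge (F⊆F∪e g∈F) (inj₁ refl)) (reach-merge (proj₂ (ends g)))))
  reach-/e⇒reach (step {e = g} r g∈F (inj₂ eq)) with ,-injective eq
  ... | refl , refl = reach-trans (reach-/e⇒reach r) (reach-trans (reach-sym (reach-merge (proj₂ (ends g))))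
                        (reach-trans (reach-edge (F⊆F∪e g∈F) (inj₂ refl)) (reach-merge (proj₁ (ends g)))))

  incident-/e : ∀ {g w x} → Incident G g w x → Incident G/e g (merge w) (merge x)
  incident-/e (inj₁ eq) = inj₁ (cong merge-ends eq)
  incident-/e (inj₂ eq) = inj₂ (cong merge-ends eq)

  merge-incident-e : ∀ {w x} → Incident G e w x → merge w ≡ merge x
  merge-incident-e (inj₁ eq) with ,-injective (trans (sym eq) ends-e)
  ... | refl , refl = trans (merge-≢b a≢b) (sym merge-b)
  merge-incident-e (inj₂ eq) with ,-injective (trans (sym eq) ends-e)
  ... | refl , refl = trans merge-b (sym (merge-≢b a≢b))

  reach⇒reach-/e : ∀ {F p q} → Reach G (F ∪ ⁅ e ⁆) p q → Reach G/e F (merge p) (merge q)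
  reach⇒reach-/e here = here
  reach⇒reach-/e {F} (step r m i) with x∈p∪q⁻ F ⁅ e ⁆ m
  ... | inj₁ g∈F = step (reach⇒reach-/e r) g∈F (incident-/e i)
  ... | inj₂ g∈e rewrite x∈⁅y⁆⇒x≡y e g∈e = subst (Reach G/e F _) (merge-incident-e i) (reach⇒reach-/e r)

  b-isolated : ∀ {F q} → Reach G/e F b q → q ≡ b
  b-isolated here = refl
  b-isolated (step {e = g} r _ (inj₁ eq)) with b-isolated r
  ... | refl = ⊥-elim (merge≢b (proj₁ (ends g)) (proj₁ (,-injective eq)))
  b-isolated (step {e = g} r _ (inj₂ eq)) with b-isolated r
  ... | refl = ⊥-elim (merge≢b (proj₂ (ends g)) (proj₂ (,-injective eq)))

  isForest-/e⇔ : ∀ {F} → e ∉ F → IsForest G/e F ⇔ IsForest G (F ∪ ⁅ e ⁆)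
  isForest-/e⇔ {F} e∉F = mk⇔ lift lower
    where
      lower : IsForest G (F ∪ ⁅ e ⁆) → IsForest G/e F
      lower fo g p q g∈F hg r with ,-injective hg
      ... | refl , refl = fo g _ _ (F⊆F∪e g∈F) refl
        (subst (λ F′ → Reach G F′ _ _) (sym (p∪x─y≡p─y∪x F (∈∧∉⇒≢ g∈F e∉F)))
          (reach-trans (reach-merge (proj₁ (ends g))) (reach-trans (reach-/e⇒reach r) (reach-sym (reach-merge (proj₂ (ends g)))))))
      lift : IsForest G/e F → IsForest G (F ∪ ⁅ e ⁆)
      lift fo = isForest-∪⁅e⁆ foG e∉F ends-e ¬ab
        where
          foG : IsForest G F
          foG g p q g∈F hg r = fo g (merge p) (merge q) g∈F (cong merge-ends hg) (reach⇒reach-/e (reach-mono F⊆F∪e r))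
          -- the last edge f of an F-walk from a to b would close a cycle through a = merge b in G / e
          ¬ab : ¬ Reach G F a b
          ¬ab r with reach⇒lastEdge (suc ∣ F ∣) F (n<1+n ∣ F ∣) r a≢b
          ... | f , w , f∈F , i , r-aw = closes-cycle (incident-/e i)
            where
              r-aw′ : Reach G/e (F ─ ⁅ f ⁆) a (merge w)
              r-aw′ = subst (λ x → Reach G/e (F ─ ⁅ f ⁆) x (merge w)) (merge-≢b a≢b) (reach⇒reach-/e (reach-mono F⊆F∪e r-aw))
              closes-cycle : Incident G/e f (merge w) (merge b) → Empty
              closes-cycle (inj₁ eq) = fo f _ _ f∈F eq (subst (Reach G/e (F ─ ⁅ f ⁆) (merge w)) (sym merge-b) (/e.reach-sym r-aw′))
              closes-cycle (inj₂ eq) = fo f _ _ f∈F eq (subst (λ x → Reach G/e (F ─ ⁅ f ⁆) x (merge w)) (sym merge-b) r-aw′)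

  private
    contractT-at : Subset v → Fin v → Bool
    contractT-at T x with x ≟ᶠ b | x ≟ᶠ a
    ... | yes _ | _     = false
    ... | no _  | yes _ = lookup T a xor lookup T b
    ... | no _  | no _  = lookup T x

  contractT : Subset v → Subset v
  contractT T = tabulate (contractT-at T)

  lookup-contractT-b : ∀ T → lookup (contractT T) b ≡ false
  lookup-contractT-b T rewrite lookup∘tabulate (contractT-at T) b with b ≟ᶠ b
  ... | yes _   = refl
  ... | no b≢b = ⊥-elim (b≢b refl)

  lookup-contractT-a : ∀ T → lookup (contractT T) a ≡ (lookup T a xor lookup T b)
  lookup-contractT-a T rewrite lookup∘tabulate (contractT-at T) a with a ≟ᶠ b | a ≟ᶠ a
  ... | yes a≡b | _       = ⊥-elim (a≢b a≡b)
  ... | no _    | yes _   = refl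
  ... | no _    | no a≢a = ⊥-elim (a≢a refl)

  lookup-contractT-y : ∀ T {x} → x ≢ a → x ≢ b → lookup (contractT T) x ≡ lookup T x
  lookup-contractT-y T {x} x≢a x≢b rewrite lookup∘tabulate (contractT-at T) x with x ≟ᶠ b | x ≟ᶠ a
  ... | yes x≡b | _       = ⊥-elim (x≢b x≡b)
  ... | no _    | yes x≡a = ⊥-elim (x≢a x≡a)
  ... | no _    | no _    = refl

  Unseparated : Subset v → Set
  Unseparated S = lookup S a ≡ lookup S b

  module _ (T S : Subset v) where
    private
      S′∩T′ = (S ─ ⁅ b ⁆) ∩ contractT T

    lookup-∩-contractT-a : Unseparated S → lookup S′∩T′ a ≡ (lookup (S ∩ T) a xor lookup (S ∩ T) b)
    lookup-∩-contractT-a unsep = begin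
      lookup S′∩T′ a                                            ≡⟨ lookup-∩ (S ─ ⁅ b ⁆) (contractT T) a ⟩
      lookup (S ─ ⁅ b ⁆) a ∧ lookup (contractT T) a              ≡⟨ cong₂ _∧_ (lookup-─⁅x⁆-y S a≢b) (lookup-contractT-a T) ⟩
      lookup S a ∧ (lookup T a xor lookup T b)                   ≡⟨ ∧-distribˡ-xor (lookup S a) _ _ ⟩
      (lookup S a ∧ lookup T a) xor (lookup S a ∧ lookup T b)    ≡⟨ cong (λ t → (lookup S a ∧ lookup T a) xor (t ∧ lookup T b)) unsep ⟩
      (lookup S a ∧ lookup T a) xor (lookup S b ∧ lookup T b)    ≡⟨ sym (cong₂ _xor_ (lookup-∩ S T a) (lookup-∩ S T b)) ⟩
      lookup (S ∩ T) a xor lookup (S ∩ T) b                      ∎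
      where open ≡-Reasoning

    lookup-∩-contractT-b : lookup S′∩T′ b ≡ false
    lookup-∩-contractT-b = trans (lookup-∩ (S ─ ⁅ b ⁆) (contractT T) b) (cong (_∧ _) (lookup-─⁅x⁆-x S b))

    rest-∩-contractT : rest S′∩T′ ≡ rest (S ∩ T)
    rest-∩-contractT = rest-cong λ x x≢a x≢b →
      trans (lookup-∩ (S ─ ⁅ b ⁆) (contractT T) x)
      (trans (cong₂ _∧_ (lookup-─⁅x⁆-y S x≢b) (lookup-contractT-y T x≢a x≢b)) (sym (lookup-∩ S T x)))

    odd-∩-contractT⇔ : Unseparated S → Odd ∣ S ∩ T ∣ ⇔ Odd ∣ S′∩T′ ∣
    odd-∩-contractT⇔ unsep = subst₂ (λ m m′ → Odd m ⇔ Odd m′) (sym (∣∣≡𝟙+𝟙+∣rest∣ (S ∩ T))) (sym count′)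
      (odd-𝟙+𝟙⇔odd-𝟙-xor (lookup (S ∩ T) a) (lookup (S ∩ T) b) ∣ rest (S ∩ T) ∣)
      where
        count′ : ∣ S′∩T′ ∣ ≡ 𝟙 (lookup (S ∩ T) a xor lookup (S ∩ T) b) + ∣ rest (S ∩ T) ∣
        count′ = trans (∣∣≡𝟙+𝟙+∣rest∣ S′∩T′)
          (cong₂ (λ x r → 𝟙 x + r) (lookup-∩-contractT-a unsep)
                 (cong₂ (λ y r → 𝟙 y + ∣ r ∣) lookup-∩-contractT-b rest-∩-contractT))

    ∩-contractT-≡⊥ : Unseparated S → S ∩ T ≡ ⊥ → S′∩T′ ≡ ⊥
    ∩-contractT-≡⊥ unsep S∩T≡⊥ = ≡⊥-by-points S′∩T′
      (trans (lookup-∩-contractT-a unsep) (cong₂ _xor_ (empty a) (empty b)))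
      lookup-∩-contractT-b
      (trans rest-∩-contractT (trans (cong rest S∩T≡⊥) rest-⊥))
      where
        empty : ∀ x → lookup (S ∩ T) x ≡ false
        empty x = trans (cong (λ X → lookup X x) S∩T≡⊥) (lookup-⊥ x)

    Pair : Set
    Pair = a ∈ S ∩ T × b ∈ S ∩ T × rest (S ∩ T) ≡ ⊥

    ∩-contractT-≡⊥⁻ : Unseparated S → S′∩T′ ≡ ⊥ → S ∩ T ≡ ⊥ ⊎ Pair
    ∩-contractT-≡⊥⁻ unsep S′∩T′≡⊥ = by-points (lookup (S ∩ T) a) (lookup (S ∩ T) b) refl refl
      (trans (sym (lookup-∩-contractT-a unsep)) (empty a))
      where
        empty : ∀ x → lookup S′∩T′ x ≡ false
        empty x = trans (cong (λ X → lookup X x) S′∩T′≡⊥) (lookup-⊥ x)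
        rest≡⊥ : rest (S ∩ T) ≡ ⊥
        rest≡⊥ = trans (sym rest-∩-contractT) (trans (cong rest S′∩T′≡⊥) rest-⊥)
        by-points : ∀ x y → lookup (S ∩ T) a ≡ x → lookup (S ∩ T) b ≡ y → x xor y ≡ false → S ∩ T ≡ ⊥ ⊎ Pair
        by-points false false ea eb _ = inj₁ (≡⊥-by-points (S ∩ T) ea eb rest≡⊥)
        by-points true  true  ea eb _ = inj₂ (lookup⇒∈ ea , lookup⇒∈ eb , rest≡⊥)
        by-points true  false _  _  ()
        by-points false true  _  _  ()

  lookup-─b-merge : ∀ S → Unseparated S → ∀ c → lookup (S ─ ⁅ b ⁆) (merge c) ≡ lookup S c
  lookup-─b-merge S unsep c = by-cases (c ≟ᶠ b)
    where
      by-cases : Dec (c ≡ b) → lookup (S ─ ⁅ b ⁆) (merge c) ≡ lookup S c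
      by-cases (yes refl) = trans (cong (lookup (S ─ ⁅ b ⁆)) merge-b) (trans (lookup-─⁅x⁆-y S a≢b) unsep)
      by-cases (no c≢b)   = trans (cong (lookup (S ─ ⁅ b ⁆)) (merge-≢b c≢b)) (lookup-─⁅x⁆-y S c≢b)

  closed-/e : ∀ {E S} → Unseparated S → Closed G E S → Closed G/e (E ─ ⁅ e ⁆) (S ─ ⁅ b ⁆)
  closed-/e {E} {S} unsep cl g p q g∈ hg with ,-injective hg
  ... | refl , refl = ⇔-trans (lookup-≡⇒∈⇔ (lookup-─b-merge S unsep (proj₁ (ends g))))
                     (⇔-trans (cl g _ _ (proj₁ (x∈p─q⁻ E ⁅ e ⁆ g∈)) refl)
                              (lookup-≡⇒∈⇔ (sym (lookup-─b-merge S unsep (proj₂ (ends g))))))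

  merge⁻¹ : Subset v → Subset v
  merge⁻¹ S′ = tabulate (lookup S′ ∘ merge)

  lookup-merge⁻¹ : ∀ S′ x → lookup (merge⁻¹ S′) x ≡ lookup S′ (merge x)
  lookup-merge⁻¹ S′ = lookup∘tabulate (lookup S′ ∘ merge)

  closed-merge⁻¹ : ∀ {E S′} → Closed G/e (E ─ ⁅ e ⁆) S′ → Closed G E (merge⁻¹ S′)
  closed-merge⁻¹ {E} {S′} cl g c d g∈E hg with g ≟ᶠ e
  ... | yes refl with ,-injective (trans (sym hg) ends-e)
  ... | refl , refl = lookup-≡⇒∈⇔ (trans (lookup-merge⁻¹ S′ a)
                        (trans (cong (lookup S′) (trans (merge-≢b a≢b) (sym merge-b))) (sym (lookup-merge⁻¹ S′ b))))
  closed-merge⁻¹ {E} {S′} cl g c d g∈E hg | no g≢e =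
    ⇔-trans (lookup-≡⇒∈⇔ (lookup-merge⁻¹ S′ c))
      (⇔-trans (cl g (merge c) (merge d) (x∈p∧x≢y⇒x∈p-y g∈E g≢e) (cong merge-ends hg))
               (lookup-≡⇒∈⇔ (sym (lookup-merge⁻¹ S′ d))))

  -- The F₁-component of a contains b, so it would meet T in exactly {a, b}.
  ¬pair : ∀ {E T F₁ S} → Feasible G E T F₁ → e ∈ F₁ → Closed G E S → ¬ Pair T S
  ¬pair {E} {T} {F₁} {S} (F₁⊆E , _ , ts) e∈F₁ cl (a∈S∩T , b∈S∩T , rest≡⊥) with ts a
  ... | R , h , component = refute component
    where
      a∈S = proj₁ (x∈p∩q⁻ S T a∈S∩T)
      R⊆S : R ⊆ S
      R⊆S {w} m = closed-reach cl F₁⊆E a∈S (to (h w) m)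
      in-R∩T : ∀ {x} → x ∈ S ∩ T → Reach G F₁ a x → x ∈ R ∩ T
      in-R∩T {x} x∈S∩T r = x∈p∩q⁺ (from (h x) r , proj₂ (x∈p∩q⁻ S T x∈S∩T))
      a∈R∩T : a ∈ R ∩ T
      a∈R∩T = in-R∩T a∈S∩T here
      b∈R∩T : b ∈ R ∩ T
      b∈R∩T = in-R∩T b∈S∩T (reach-edge e∈F₁ (inj₁ ends-e))
      rest-R∩T≡⊥ : rest (R ∩ T) ≡ ⊥
      rest-R∩T≡⊥ = ⊆-antisym
        (λ m → subst (_ ∈_) rest≡⊥ (─-monoˡ ⁅ b ⁆ (─-monoˡ ⁅ a ⁆ R∩T⊆S∩T) m)) (λ m → ⊥-elim (∉⊥ m))
        where
          R∩T⊆S∩T : R ∩ T ⊆ S ∩ T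
          R∩T⊆S∩T m = let x∈R , x∈T = x∈p∩q⁻ R T m in x∈p∩q⁺ (R⊆S x∈R , x∈T)
      ∣R∩T∣≡2 : ∣ R ∩ T ∣ ≡ 2
      ∣R∩T∣≡2 = begin
        ∣ R ∩ T ∣                                                         ≡⟨ ∣∣≡𝟙+𝟙+∣rest∣ (R ∩ T) ⟩
        𝟙 (lookup (R ∩ T) a) + (𝟙 (lookup (R ∩ T) b) + ∣ rest (R ∩ T) ∣) ≡⟨ cong₂ (λ x y → 𝟙 x + (𝟙 y + ∣ rest (R ∩ T) ∣)) (∈⇒lookup a∈R∩T) (∈⇒lookup b∈R∩T) ⟩
        2 + ∣ rest (R ∩ T) ∣                                              ≡⟨ cong (λ r → 2 + ∣ r ∣) rest-R∩T≡⊥ ⟩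
        2 + ∣ ⊥ {v} ∣                                                     ≡⟨ cong (2 +_) (∣⊥∣≡0 v) ⟩
        2                                                                 ∎
        where open ≡-Reasoning
      refute : TComponent E T R → Empty
      refute (inj₁ odd)           = ¬odd-0 (from (odd⇔odd-2+ 0) (subst Odd ∣R∩T∣≡2 odd))
      refute (inj₂ (R∩T≡⊥ , _)) = ∉⊥ (subst (a ∈_) R∩T≡⊥ a∈R∩T)

  tSpanningAt-b : ∀ {E T F} → /e.TSpanningAt (E ─ ⁅ e ⁆) (contractT T) F b
  tSpanningAt-b {E} {T} {F} =
    ⁅ b ⁆ , (λ w → mk⇔ (λ m → subst (Reach G/e F b) (sym (x∈⁅y⁆⇒x≡y b m)) here)
                       (λ r → subst (_∈ ⁅ b ⁆) (sym (b-isolated r)) (x∈⁅x⁆ b)))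
          , inj₂ (⁅b⁆∩T′≡⊥ , ⁅b⁆-closed)
    where
      ⁅b⁆∩T′≡⊥ : ⁅ b ⁆ ∩ contractT T ≡ ⊥
      ⁅b⁆∩T′≡⊥ = ⊆-antisym (λ m → let x∈b , x∈T′ = x∈p∩q⁻ ⁅ b ⁆ (contractT T) m
                                   in ⊥-elim (lookup⇒∉ (lookup-contractT-b T) (subst (_∈ contractT T) (x∈⁅y⁆⇒x≡y b x∈b) x∈T′)))
                           (λ m → ⊥-elim (∉⊥ m))
      ⁅b⁆-closed : Closed G/e (E ─ ⁅ e ⁆) ⁅ b ⁆
      ⁅b⁆-closed g p q _ hg with ,-injective hg
      ... | refl , refl = mk⇔ (λ m → ⊥-elim (merge≢b (proj₁ (ends g)) (x∈⁅y⁆⇒x≡y b m)))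
                              (λ m → ⊥-elim (merge≢b (proj₂ (ends g)) (x∈⁅y⁆⇒x≡y b m)))

  tSpanningAt-/e : ∀ {E T F u} → u ≢ b → TSpanningAt E T (F ∪ ⁅ e ⁆) u → /e.TSpanningAt (E ─ ⁅ e ⁆) (contractT T) F u
  tSpanningAt-/e {E} {T} {F} {u} u≢b (S , h , component) = S ─ ⁅ b ⁆ , h′ , condition component
    where
      unsep : Unseparated S
      unsep = ∈⇔⇒lookup-≡ (mk⇔ (λ a∈S → from (h b) (reach-trans (to (h a) a∈S) ab))
                               (λ b∈S → from (h a) (reach-trans (to (h b) b∈S) (reach-sym ab))))
        where ab = reach-edge e∈F∪e (inj₁ ends-e)
      h′ : ∀ w → w ∈ S ─ ⁅ b ⁆ ⇔ Reach G/e F u w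
      h′ w = mk⇔
        (λ m → let w∈S , w∉b = x∈p─q⁻ S ⁅ b ⁆ m
               in subst₂ (Reach G/e F) (merge-≢b u≢b) (merge-≢b (x∉⁅y⁆⇒x≢y w∉b)) (reach⇒reach-/e (to (h w) w∈S)))
        (λ r → x∈p∧x≢y⇒x∈p-y (from (h w) (reach-/e⇒reach r)) (λ { refl → u≢b (b-isolated (/e.reach-sym r)) }))
      condition : TComponent E T S → /e.TComponent (E ─ ⁅ e ⁆) (contractT T) (S ─ ⁅ b ⁆)
      condition (inj₁ odd)             = inj₁ (to (odd-∩-contractT⇔ T S unsep) odd)
      condition (inj₂ (S∩T≡⊥ , cl)) = inj₂ (∩-contractT-≡⊥ T S unsep S∩T≡⊥ , closed-/e unsep cl)

  tSpanningAt-∪e : ∀ {E T F₁ F u} → Feasible G E T F₁ → e ∈ F₁ →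
                   /e.TSpanningAt (E ─ ⁅ e ⁆) (contractT T) F (merge u) → TSpanningAt E T (F ∪ ⁅ e ⁆) u
  tSpanningAt-∪e {E} {T} {F₁} {F} {u} feasible₁ e∈F₁ (S′ , h′ , component) = S , h , condition component
    where
      S = merge⁻¹ S′
      h : ∀ w → w ∈ S ⇔ Reach G (F ∪ ⁅ e ⁆) u w
      h w = mk⇔
        (λ m → reach-trans (reach-merge u) (reach-trans
                 (reach-/e⇒reach (to (h′ (merge w)) (lookup⇒∈ (trans (sym (lookup-merge⁻¹ S′ w)) (∈⇒lookup m)))))
                 (reach-sym (reach-merge w))))
        (λ r → lookup⇒∈ (trans (lookup-merge⁻¹ S′ w) (∈⇒lookup (from (h′ (merge w)) (reach⇒reach-/e r)))))
      unsep : Unseparated S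
      unsep = trans (lookup-merge⁻¹ S′ a)
                (trans (cong (lookup S′) (trans (merge-≢b a≢b) (sym merge-b))) (sym (lookup-merge⁻¹ S′ b)))
      S─b≡S′ : S ─ ⁅ b ⁆ ≡ S′
      S─b≡S′ = lookup-ext-at b
        (trans (lookup-─⁅x⁆-x S b) (sym (∉⇒lookup b∉S′)))
        (λ x x≢b → trans (lookup-─⁅x⁆-y S x≢b) (trans (lookup-merge⁻¹ S′ x) (cong (lookup S′) (merge-≢b x≢b))))
        where
          b∉S′ : b ∉ S′
          b∉S′ m = merge≢b u (b-isolated (/e.reach-sym (to (h′ b) m)))
      condition : /e.TComponent (E ─ ⁅ e ⁆) (contractT T) S′ → TComponent E T S
      condition (inj₁ odd) = inj₁ (from (odd-∩-contractT⇔ T S unsep) (subst (λ X → Odd ∣ X ∩ contractT T ∣) (sym S─b≡S′) odd))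
      condition (inj₂ (S′∩T′≡⊥ , cl))
        with ∩-contractT-≡⊥⁻ T S unsep (subst (λ X → X ∩ contractT T ≡ ⊥) (sym S─b≡S′) S′∩T′≡⊥)
      ... | inj₁ S∩T≡⊥ = inj₂ (S∩T≡⊥ , closed-merge⁻¹ cl)
      ... | inj₂ pair  = ⊥-elim (¬pair feasible₁ e∈F₁ (closed-merge⁻¹ cl) pair)

  feasible-∪e⇒feasible-/e : ∀ {E T F} → e ∉ F → Feasible G E T (F ∪ ⁅ e ⁆) →
                            Feasible G/e (E ─ ⁅ e ⁆) (contractT T) F
  feasible-∪e⇒feasible-/e {E} {T} {F} e∉F (F∪e⊆E , fo , ts) =
    (λ m → x∈p∧x≢y⇒x∈p-y (F∪e⊆E (F⊆F∪e m)) (∈∧∉⇒≢ m e∉F)) , from (isForest-/e⇔ e∉F) fo , ts′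
    where
      ts′ : TSpanning G/e (E ─ ⁅ e ⁆) (contractT T) F
      ts′ u with u ≟ᶠ b
      ... | yes refl = tSpanningAt-b
      ... | no u≢b   = tSpanningAt-/e u≢b (ts u)

  feasible-/e⇒feasible-∪e : ∀ {E T F₁ F} → Feasible G E T F₁ → e ∈ F₁ →
                            Feasible G/e (E ─ ⁅ e ⁆) (contractT T) F → e ∉ F × Feasible G E T (F ∪ ⁅ e ⁆)
  feasible-/e⇒feasible-∪e {E} {T} {F₁} {F} feasible₁ e∈F₁ (F⊆E-e , fo , ts) =
    e∉F , (F∪e⊆E , to (isForest-/e⇔ e∉F) fo , λ u → tSpanningAt-∪e feasible₁ e∈F₁ (ts (merge u)))
    where
      e∉F : e ∉ F
      e∉F m = proj₂ (x∈p─q⁻ E ⁅ e ⁆ (F⊆E-e m)) (x∈⁅x⁆ e)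
      F∪e⊆E : F ∪ ⁅ e ⁆ ⊆ E
      F∪e⊆E m with x∈p∪q⁻ F ⁅ e ⁆ m
      ... | inj₁ m′ = proj₁ (x∈p─q⁻ E ⁅ e ⁆ (F⊆E-e m′))
      ... | inj₂ m′ rewrite x∈⁅y⁆⇒x≡y e m′ = proj₁ feasible₁ e∈F₁

  feasible-/e⇔ : ∀ {E T F₁} → Feasible G E T F₁ → e ∈ F₁ →
                 ∀ F → Feasible G/e (E ─ ⁅ e ⁆) (contractT T) F ⇔ (e ∉ F × Feasible G E T (F ∪ ⁅ e ⁆))
  feasible-/e⇔ feasible₁ e∈F₁ F =
    mk⇔ (feasible-/e⇒feasible-∪e feasible₁ e∈F₁) (λ (e∉F , feasible) → feasible-∪e⇒feasible-/e e∉F feasible)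

-- Set systems: deletion, contraction and twisting

SetSystem : ℕ → Set₁
SetSystem n = Subset n → Set

infix 4 _≐_
_≐_ : SetSystem n → SetSystem n → Set
P ≐ Q = ∀ Y → P Y ⇔ Q Y

infixl 6 _∖ˢ_ _/ˢ_
_∖ˢ_ : SetSystem n → Fin n → SetSystem n
(P ∖ˢ e) Y = P Y × e ∉ Y

_/ˢ_ : SetSystem n → Fin n → SetSystem n
(P /ˢ e) Y = e ∉ Y × P (Y ∪ ⁅ e ⁆)

∖ˢ-cong : {P Q : SetSystem n} (e : Fin n) → P ≐ Q → P ∖ˢ e ≐ Q ∖ˢ e
∖ˢ-cong e P≐Q Y = mk⇔ (λ (p , e∉Y) → to (P≐Q Y) p , e∉Y) (λ (q , e∉Y) → from (P≐Q Y) q , e∉Y)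

/ˢ-cong : {P Q : SetSystem n} (e : Fin n) → P ≐ Q → P /ˢ e ≐ Q /ˢ e
/ˢ-cong e P≐Q Y = mk⇔ (λ (e∉Y , p) → e∉Y , to (P≐Q _) p) (λ (e∉Y , q) → e∉Y , from (P≐Q _) q)

∈⇒∃-/ˢ : {P : SetSystem n} {Y : Subset n} {e : Fin n} → P Y → e ∈ Y → ∃ (P /ˢ e)
∈⇒∃-/ˢ {P = P} {Y} {e} p e∈Y = Y ─ ⁅ e ⁆ , x∉p─x Y e , subst P (sym (p─x∪x≡p e∈Y)) p

Twisted : SetSystem n → Subset n → SetSystem n
Twisted 𝓕 X Y = ∃ λ F → 𝓕 F × Y ≡ F △ X

twisted-cong : {𝓕 𝓖 : SetSystem n} (X : Subset n) → 𝓕 ≐ 𝓖 → Twisted 𝓕 X ≐ Twisted 𝓖 X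
twisted-cong X 𝓕≐𝓖 Y = mk⇔ (λ (F , f , eq) → F , to (𝓕≐𝓖 F) f , eq) (λ (F , g , eq) → F , from (𝓕≐𝓖 F) g , eq)

twisted⇒∃ : {𝓕 : SetSystem n} {X Y : Subset n} → Twisted 𝓕 X Y → ∃ 𝓕
twisted⇒∃ (F , f , _) = F , f

twisted⇔ : {𝓕 : SetSystem n} (X Y : Subset n) → Twisted 𝓕 X Y ⇔ 𝓕 (Y △ X)
twisted⇔ {𝓕 = 𝓕} X Y = mk⇔
  (λ (F , f , Y≡F△X) → subst 𝓕 (sym (trans (cong (_△ X) Y≡F△X) (△-involutiveʳ F X))) f)
  (λ f → Y △ X , f , sym (△-involutiveʳ Y X))

module _ {𝓕 : SetSystem n} {X : Subset n} {e : Fin n} where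
  private
    X′ = X ─ ⁅ e ⁆

    split : ∀ {F} → e ∈ F → F ≡ (F ─ ⁅ e ⁆) ∪ ⁅ e ⁆
    split e∈F = sym (p─x∪x≡p e∈F)

    △-∪⁅e⁆ : ∀ {p q} → e ∉ p → e ∉ q → p △ (q ∪ ⁅ e ⁆) ≡ (p △ q) ∪ ⁅ e ⁆
    △-∪⁅e⁆ {p} {q} e∉p e∉q =
      trans (△-comm p (q ∪ ⁅ e ⁆)) (trans (∪⁅x⁆-△ e∉q e∉p) (cong (_∪ ⁅ e ⁆) (△-comm q p)))

    e∈Y∪e : ∀ Y → e ∈ Y ∪ ⁅ e ⁆
    e∈Y∪e Y = q⊆p∪q Y ⁅ e ⁆ (x∈⁅x⁆ e)

  twisted-∖ˢ : e ∉ X → Twisted 𝓕 X ∖ˢ e ≐ Twisted (𝓕 ∖ˢ e) X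
  twisted-∖ˢ e∉X Y = mk⇔
    (λ ((F , f , Y≡F△X) , e∉Y) → F , (f , λ e∈F → e∉Y (subst (e ∈_) (sym Y≡F△X) (x∈p△q⁺ˡ e∈F e∉X))) , Y≡F△X)
    (λ (F , (f , e∉F) , Y≡F△X) → (F , f , Y≡F△X) , subst (e ∉_) (sym Y≡F△X) (∉-△ e∉F e∉X))

  twisted-∖ˢ-∈ : e ∈ X → Twisted 𝓕 X ∖ˢ e ≐ Twisted (𝓕 /ˢ e) X′
  twisted-∖ˢ-∈ e∈X Y = mk⇔
    (λ ((F , f , Y≡F△X) , e∉Y) → case-F F f Y≡F△X e∉Y (e ∈? F))
    (λ (F′ , (e∉F′ , f) , Y≡F′△X′) → (F′ ∪ ⁅ e ⁆ , f ,
        trans Y≡F′△X′ (trans (sym (∪⁅x⁆-△-∪⁅x⁆ e∉F′ (x∉p─x X e))) (cong ((F′ ∪ ⁅ e ⁆) △_) (sym (split e∈X)))))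
      , subst (e ∉_) (sym Y≡F′△X′) (∉-△ e∉F′ (x∉p─x X e)))
    where
      case-F : ∀ F → 𝓕 F → Y ≡ F △ X → e ∉ Y → Dec (e ∈ F) → Twisted (𝓕 /ˢ e) X′ Y
      case-F F f Y≡F△X e∉Y (no e∉F) = ⊥-elim (e∉Y (subst (e ∈_) (sym Y≡F△X) (x∈p△q⁺ʳ e∉F e∈X)))
      case-F F f Y≡F△X e∉Y (yes e∈F) =
        F ─ ⁅ e ⁆ , (x∉p─x F e , subst 𝓕 (split e∈F) f) ,
        trans Y≡F△X (trans (cong₂ _△_ (split e∈F) (split e∈X)) (∪⁅x⁆-△-∪⁅x⁆ (x∉p─x F e) (x∉p─x X e)))

  twisted-/ˢ : e ∉ X → Twisted 𝓕 X /ˢ e ≐ Twisted (𝓕 /ˢ e) X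
  twisted-/ˢ e∉X Y = mk⇔
    (λ (e∉Y , F , f , Y∪e≡F△X) → case-F F f Y∪e≡F△X e∉Y (e ∈? F))
    (λ (F′ , (e∉F′ , f) , Y≡F′△X) → subst (e ∉_) (sym Y≡F′△X) (∉-△ e∉F′ e∉X) ,
        F′ ∪ ⁅ e ⁆ , f , trans (cong (_∪ ⁅ e ⁆) Y≡F′△X) (sym (∪⁅x⁆-△ e∉F′ e∉X)))
    where
      case-F : ∀ F → 𝓕 F → Y ∪ ⁅ e ⁆ ≡ F △ X → e ∉ Y → Dec (e ∈ F) → Twisted (𝓕 /ˢ e) X Y
      case-F F f Y∪e≡F△X e∉Y (no e∉F) = ⊥-elim (∉-△ e∉F e∉X (subst (e ∈_) Y∪e≡F△X (e∈Y∪e Y)))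
      case-F F f Y∪e≡F△X e∉Y (yes e∈F) =
        F ─ ⁅ e ⁆ , (x∉p─x F e , subst 𝓕 (split e∈F) f) ,
        ∪⁅x⁆-injective e∉Y (∉-△ (x∉p─x F e) e∉X)
          (trans Y∪e≡F△X (trans (cong (_△ X) (split e∈F)) (∪⁅x⁆-△ (x∉p─x F e) e∉X)))

  twisted-/ˢ-∈ : e ∈ X → Twisted 𝓕 X /ˢ e ≐ Twisted (𝓕 ∖ˢ e) X′
  twisted-/ˢ-∈ e∈X Y = mk⇔
    (λ (e∉Y , F , f , Y∪e≡F△X) → case-F F f Y∪e≡F△X e∉Y (e ∈? F))
    (λ (F , (f , e∉F) , Y≡F△X′) → subst (e ∉_) (sym Y≡F△X′) (∉-△ e∉F (x∉p─x X e)) ,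
        F , f , trans (cong (_∪ ⁅ e ⁆) Y≡F△X′) (trans (sym (△-∪⁅e⁆ e∉F (x∉p─x X e))) (cong (F △_) (sym (split e∈X)))))
    where
      case-F : ∀ F → 𝓕 F → Y ∪ ⁅ e ⁆ ≡ F △ X → e ∉ Y → Dec (e ∈ F) → Twisted (𝓕 ∖ˢ e) X′ Y
      case-F F f Y∪e≡F△X e∉Y (yes e∈F) = ⊥-elim (x∈p∧x∈q⇒x∉p△q e∈F e∈X (subst (e ∈_) Y∪e≡F△X (e∈Y∪e Y)))
      case-F F f Y∪e≡F△X e∉Y (no e∉F) =
        F , (f , e∉F) ,
        ∪⁅x⁆-injective e∉Y (∉-△ e∉F (x∉p─x X e))
          (trans Y∪e≡F△X (trans (cong (F △_) (split e∈X)) (△-∪⁅e⁆ e∉F (x∉p─x X e))))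

FeasibleFamily : Subset n → SetSystem n → Set
FeasibleFamily {n} E 𝓕 = Σ (Graph n) λ G → Σ (Subset (Graph.v G)) λ T → Feasible G E T ≐ 𝓕

feasibleFamily-∖ˢ : {E : Subset n} {𝓕 : SetSystem n} {e : Fin n} →
                    FeasibleFamily E 𝓕 → ∃ (𝓕 ∖ˢ e) → FeasibleFamily (E ─ ⁅ e ⁆) (𝓕 ∖ˢ e)
feasibleFamily-∖ˢ {e = e} (G , T , 𝓕≐) (F₀ , f₀ , e∉F₀) =
  G , T , λ F → ⇔-trans (Deletion.feasible-delete⇔ G (from (𝓕≐ F₀) f₀) e∉F₀ F) (∖ˢ-cong e 𝓕≐ F)

feasibleFamily-/ˢ : {E : Subset n} {𝓕 : SetSystem n} {e : Fin n} →
                    FeasibleFamily E 𝓕 → ∃ (𝓕 /ˢ e) → FeasibleFamily (E ─ ⁅ e ⁆) (𝓕 /ˢ e)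
feasibleFamily-/ˢ {e = e} (G , T , 𝓕≐) (F′ , e∉F′ , f) =
  G/e , contractT T , λ F → ⇔-trans (feasible-/e⇔ feasible₁ e∈F₁ F) (/ˢ-cong e 𝓕≐ F)
  where
    F₁ = F′ ∪ ⁅ e ⁆
    feasible₁ = from (𝓕≐ F₁) f
    e∈F₁ = q⊆p∪q F′ ⁅ e ⁆ (x∈⁅x⁆ e)
    open Contraction G e refl (Reachability.isForest⇒¬loop G (proj₁ (proj₂ feasible₁)) e∈F₁ refl)

deltaGraphic : {E : Subset n} {P 𝓕 : SetSystem n} (X : Subset n) →
               FeasibleFamily E 𝓕 → X ⊆ E → P ≐ Twisted 𝓕 X → DeltaGraphic E P
deltaGraphic X (G , T , 𝓕≐) X⊆E P≐ = G , T , X , X⊆E , λ Y → ⇔-trans (P≐ Y) (twisted-cong X (⇔-sym ∘ 𝓕≐) Y)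

DeltaGraphic-cong : {E : Subset n} {P Q : SetSystem n} → P ≐ Q → DeltaGraphic E P → DeltaGraphic E Q
DeltaGraphic-cong P≐Q (G , T , X , X⊆E , P≐) = G , T , X , X⊆E , λ Y → ⇔-trans (⇔-sym (P≐Q Y)) (P≐ Y)

deltaGraphic⇒decidable : {E : Subset n} {P : SetSystem n} → DeltaGraphic E P → ∀ Y → Dec (P Y)
deltaGraphic⇒decidable {E = E} (G , T , X , _ , P≐) Y =
  map′ (from (P≐ Y) ∘ from (twisted⇔ X Y)) (to (twisted⇔ X Y) ∘ to (P≐ Y)) (FeasibleDecidable.feasible? G E T (Y △ X))

module _ {E : Subset n} {P : SetSystem n} {e : Fin n} (deltaGraphic-P : DeltaGraphic E P) where
  private
    G = proj₁ deltaGraphic-P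
    T = proj₁ (proj₂ deltaGraphic-P)
    X = proj₁ (proj₂ (proj₂ deltaGraphic-P))
    X⊆E = proj₁ (proj₂ (proj₂ (proj₂ deltaGraphic-P)))
    P≐ = proj₂ (proj₂ (proj₂ (proj₂ deltaGraphic-P)))
    𝓕 = Feasible G E T
    family : FeasibleFamily E 𝓕
    family = G , T , λ _ → mk⇔ id id
    X⊆E-e : e ∉ X → X ⊆ E ─ ⁅ e ⁆
    X⊆E-e e∉X m = x∈p∧x≢y⇒x∈p-y (X⊆E m) (∈∧∉⇒≢ m e∉X)
    X-e⊆E-e : X ─ ⁅ e ⁆ ⊆ E ─ ⁅ e ⁆
    X-e⊆E-e = ─-monoˡ ⁅ e ⁆ X⊆E

  -- Twisting by X exchanges deletion and contraction at the elements of X.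
  DeltaGraphic-∖ˢ : ∃ (P ∖ˢ e) → DeltaGraphic (E ─ ⁅ e ⁆) (P ∖ˢ e)
  DeltaGraphic-∖ˢ (Y₀ , p₀) with e ∈? X
  ... | no e∉X = deltaGraphic X (feasibleFamily-∖ˢ family (twisted⇒∃ (to (P∖e≐ Y₀) p₀))) (X⊆E-e e∉X) P∖e≐
    where
      P∖e≐ : P ∖ˢ e ≐ Twisted (𝓕 ∖ˢ e) X
      P∖e≐ Y = ⇔-trans (∖ˢ-cong e P≐ Y) (twisted-∖ˢ e∉X Y)
  ... | yes e∈X = deltaGraphic (X ─ ⁅ e ⁆) (feasibleFamily-/ˢ family (twisted⇒∃ (to (P∖e≐ Y₀) p₀))) X-e⊆E-e P∖e≐
    where
      P∖e≐ : P ∖ˢ e ≐ Twisted (𝓕 /ˢ e) (X ─ ⁅ e ⁆)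
      P∖e≐ Y = ⇔-trans (∖ˢ-cong e P≐ Y) (twisted-∖ˢ-∈ e∈X Y)

  DeltaGraphic-/ˢ : ∃ (P /ˢ e) → DeltaGraphic (E ─ ⁅ e ⁆) (P /ˢ e)
  DeltaGraphic-/ˢ (Y₀ , p₀) with e ∈? X
  ... | no e∉X = deltaGraphic X (feasibleFamily-/ˢ family (twisted⇒∃ (to (P/e≐ Y₀) p₀))) (X⊆E-e e∉X) P/e≐
    where
      P/e≐ : P /ˢ e ≐ Twisted (𝓕 /ˢ e) X
      P/e≐ Y = ⇔-trans (/ˢ-cong e P≐ Y) (twisted-/ˢ e∉X Y)
  ... | yes e∈X = deltaGraphic (X ─ ⁅ e ⁆) (feasibleFamily-∖ˢ family (twisted⇒∃ (to (P/e≐ Y₀) p₀))) X-e⊆E-e P/e≐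
    where
      P/e≐ : P /ˢ e ≐ Twisted (𝓕 ∖ˢ e) (X ─ ⁅ e ⁆)
      P/e≐ Y = ⇔-trans (/ˢ-cong e P≐ Y) (twisted-/ˢ-∈ e∈X Y)

-- Matroids with decidable bases

module MatroidTheory {n : ℕ} (M : Matroid n) (isBasis? : ∀ B → Dec (Matroid.IsBasis M B)) where
  open Matroid M

  MaxIndep : Subset n → Subset n → Set
  MaxIndep = MaxIndepIn M

  indep-⊆ : ∀ {I K} → I ⊆ K → Indep K → Indep I
  indep-⊆ I⊆K (B , b , K⊆B) = B , b , λ m → K⊆B (I⊆K m)

  indep? : ∀ I → Dec (Indep I)
  indep? I = anySubset? (λ B → isBasis? B ×-dec (I ⊆? B))

  indep-⊥ : Indep ⊥
  indep-⊥ = let B , b = nonempty in B , b , λ m → ⊥-elim (∉⊥ m)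

  basis-⊆⇒≡ : ∀ {B₁ B₂} → IsBasis B₁ → IsBasis B₂ → B₁ ⊆ B₂ → B₁ ≡ B₂
  basis-⊆⇒≡ {B₁} {B₂} b₁ b₂ B₁⊆B₂ = ⊆-antisym B₁⊆B₂ B₂⊆B₁
    where
      B₂⊆B₁ : B₂ ⊆ B₁
      B₂⊆B₁ {x} x∈B₂ with x ∈? B₁
      ... | yes x∈B₁ = x∈B₁
      ... | no  x∉B₁ = let _ , y∈B₁ , y∉B₂ , _ = exchange b₂ b₁ x∈B₂ x∉B₁ in ⊥-elim (y∉B₂ (B₁⊆B₂ y∈B₁))

  maxIndep-∩ : ∀ {S K B} → MaxIndep S K → Indep B → K ⊆ B → B ∩ S ≡ K
  maxIndep-∩ {S} {K} {B} (K⊆S , _ , maximal) iB K⊆B =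
    maximal (B ∩ S) (p∩q⊆q B S) (indep-⊆ (p∩q⊆p B S) iB) (λ m → x∈p∩q⁺ (K⊆B m , K⊆S m))

  maxIndep-restrict : ∀ {S S′ K} → S′ ⊆ S → K ⊆ S′ → MaxIndep S K → MaxIndep S′ K
  maxIndep-restrict S′⊆S K⊆S′ (_ , iK , maximal) = K⊆S′ , iK , λ K′ K′⊆S′ → maximal K′ (λ m → S′⊆S (K′⊆S′ m))

  extend : ∀ {S I} → Indep I → I ⊆ S → ∃ λ K → MaxIndep S K × I ⊆ K
  extend {S} iI I⊆S with saturate S (λ A x → indep? (A ∪ ⁅ x ⁆)) (λ _ _ _ iA∪x _ → iA∪x) I⊆S iI
  ... | K , I⊆K , K⊆S , iK , saturated = K , (K⊆S , iK , maximal) , I⊆K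
    where
      maximal : ∀ K′ → K′ ⊆ S → Indep K′ → K ⊆ K′ → K′ ≡ K
      maximal K′ K′⊆S iK′ K⊆K′ = ⊆-antisym K′⊆K K⊆K′
        where
          K′⊆K : K′ ⊆ K
          K′⊆K {x} x∈K′ with x ∈? K
          ... | yes x∈K = x∈K
          ... | no  x∉K = ⊥-elim (saturated x (K′⊆S x∈K′) x∉K (indep-⊆ K∪x⊆K′ iK′))
            where
              K∪x⊆K′ : K ∪ ⁅ x ⁆ ⊆ K′
              K∪x⊆K′ m with x∈p∪q⁻ K ⁅ x ⁆ m
              ... | inj₁ m′ = K⊆K′ m′
              ... | inj₂ m′ rewrite x∈⁅y⁆⇒x≡y x m′ = x∈K′

  isBasis⇔maxIndep : ∀ {B} → IsBasis B ⇔ MaxIndep E B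
  isBasis⇔maxIndep {B} = mk⇔
    (λ b → (λ {x} → basis⊆E b {x}) , (B , b , λ {_} m → m) , λ K _ (B′ , b′ , K⊆B′) B⊆K →
       let B≡B′ = basis-⊆⇒≡ b b′ (λ m → K⊆B′ (B⊆K m)) in ⊆-antisym (subst (K ⊆_) (sym B≡B′) K⊆B′) B⊆K)
    (λ (_ , (B′ , b′ , B⊆B′) , maximal) → subst IsBasis (maximal B′ (λ {x} → basis⊆E b′ {x}) (B′ , b′ , λ {_} m → m) B⊆B′) b′)

  exchange-towards : ∀ {B B₀ x} → IsBasis B → IsBasis B₀ → x ∈ B → x ∉ B₀ →
    ∃ λ y → y ∈ B₀ × y ∉ B × IsBasis ((B ─ ⁅ x ⁆) ∪ ⁅ y ⁆) × ∣ ((B ─ ⁅ x ⁆) ∪ ⁅ y ⁆) ─ B₀ ∣ < ∣ B ─ B₀ ∣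
  exchange-towards {B} {B₀} {x} b b₀ x∈B x∉B₀ with exchange b b₀ x∈B x∉B₀
  ... | y , y∈B₀ , y∉B , b′ = y , y∈B₀ , y∉B , b′ ,
    ≤-<-trans (p⊆q⇒∣p∣≤∣q∣ ⊆-shrunk) (x∈p⇒∣p-x∣<∣p∣ (x∈p∧x∉q⇒x∈p─q x∈B x∉B₀))
    where
      ⊆-shrunk : ((B ─ ⁅ x ⁆) ∪ ⁅ y ⁆) ─ B₀ ⊆ (B ─ B₀) ─ ⁅ x ⁆
      ⊆-shrunk {z} m with x∈p─q⁻ _ B₀ m
      ... | z∈ , z∉B₀ with x∈p∪q⁻ (B ─ ⁅ x ⁆) ⁅ y ⁆ z∈
      ... | inj₂ z∈y rewrite x∈⁅y⁆⇒x≡y y z∈y = ⊥-elim (z∉B₀ y∈B₀)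
      ... | inj₁ z∈B─x = let z∈B , z∉x = x∈p─q⁻ B ⁅ x ⁆ z∈B─x in x∈p∧x∉q⇒x∈p─q (x∈p∧x∉q⇒x∈p─q z∈B z∉B₀) z∉x

  basis-card : ∀ {B₁ B₂} → IsBasis B₁ → IsBasis B₂ → ∣ B₁ ∣ ≡ ∣ B₂ ∣
  basis-card {B₁} {B₂} b₁ b₂ = go (suc ∣ B₁ ─ B₂ ∣) b₁ (n<1+n _)
    where
      go : ∀ k {B} → IsBasis B → ∣ B ─ B₂ ∣ < k → ∣ B ∣ ≡ ∣ B₂ ∣
      go (suc k) {B} b (s≤s lt) with any? (λ x → (x ∈? B) ×-dec ¬? (x ∈? B₂))
      ... | yes (x , x∈B , x∉B₂) =
        let y , _ , y∉B , b′ , smaller = exchange-towards b b₂ x∈B x∉B₂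
        in trans (sym (∣p─x∪y∣≡∣p∣ x∈B y∉B)) (go k b′ (<-≤-trans smaller lt))
      ... | no ∄ = cong ∣_∣ (basis-⊆⇒≡ b b₂ B⊆B₂)
        where
          B⊆B₂ : B ⊆ B₂
          B⊆B₂ {x} x∈B with x ∈? B₂
          ... | yes x∈B₂ = x∈B₂
          ... | no  x∉B₂ = ⊥-elim (∄ (x , x∈B , x∉B₂))

  ∣B₁─B₂∣≡∣B₂─B₁∣ : ∀ {B₁ B₂} → IsBasis B₁ → IsBasis B₂ → ∣ B₁ ─ B₂ ∣ ≡ ∣ B₂ ─ B₁ ∣
  ∣B₁─B₂∣≡∣B₂─B₁∣ {B₁} {B₂} b₁ b₂ = +-cancelˡ-≡ ∣ B₁ ∩ B₂ ∣ _ _ (begin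
    ∣ B₁ ∩ B₂ ∣ + ∣ B₁ ─ B₂ ∣ ≡⟨ sym (∣p∣≡∣p∩q∣+∣p─q∣ B₁ B₂) ⟩
    ∣ B₁ ∣                    ≡⟨ basis-card b₁ b₂ ⟩
    ∣ B₂ ∣                    ≡⟨ ∣p∣≡∣p∩q∣+∣p─q∣ B₂ B₁ ⟩
    ∣ B₂ ∩ B₁ ∣ + ∣ B₂ ─ B₁ ∣ ≡⟨ cong (λ Z → ∣ Z ∣ + ∣ B₂ ─ B₁ ∣) (∩-comm B₂ B₁) ⟩
    ∣ B₁ ∩ B₂ ∣ + ∣ B₂ ─ B₁ ∣ ∎)
    where open ≡-Reasoning

  -- Move a basis B₂ ⊇ K₂ towards a basis B₁ ⊇ K₁ by exchanges outside S, until B₂ ─ B₁ ⊆ S.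
  maxIndep-card-≤ : ∀ {S K₁ K₂} → MaxIndep S K₁ → MaxIndep S K₂ → ∣ K₁ ∣ ≤ ∣ K₂ ∣
  maxIndep-card-≤ {S} {K₁} {K₂} max₁@(K₁⊆S , (B₁ , b₁ , K₁⊆B₁) , _) max₂@(K₂⊆S , (B , b , K₂⊆B) , _) =
    go (suc ∣ B ─ B₁ ∣) b K₂⊆B (n<1+n _)
    where
      go : ∀ k {B₂} → IsBasis B₂ → K₂ ⊆ B₂ → ∣ B₂ ─ B₁ ∣ < k → ∣ K₁ ∣ ≤ ∣ K₂ ∣
      go (suc k) {B₂} b₂ K₂⊆B₂ (s≤s lt) with any? (λ x → (x ∈? B₂) ×-dec ¬? (x ∈? B₁) ×-dec ¬? (x ∈? S))
      ... | yes (x , x∈B₂ , x∉B₁ , x∉S) =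
        let y , _ , _ , b₂′ , smaller = exchange-towards b₂ b₁ x∈B₂ x∉B₁
        in go k b₂′ (λ m → p⊆p∪q ⁅ y ⁆ (x∈p∧x≢y⇒x∈p-y (K₂⊆B₂ m) (λ { refl → x∉S (K₂⊆S m) }))) (<-≤-trans smaller lt)
      ... | no ∄ = begin
        ∣ K₁ ∣                                 ≡⟨ cong ∣_∣ (sym (maxIndep-∩ max₁ (B₁ , b₁ , λ {_} m → m) K₁⊆B₁)) ⟩
        ∣ B₁ ∩ S ∣                             ≡⟨ ∣p∣≡∣p∩q∣+∣p─q∣ (B₁ ∩ S) B₂ ⟩
        ∣ (B₁ ∩ S) ∩ B₂ ∣ + ∣ (B₁ ∩ S) ─ B₂ ∣ ≤⟨ +-mono-≤ (p⊆q⇒∣p∣≤∣q∣ swap-∩) (p⊆q⇒∣p∣≤∣q∣ (─-monoˡ B₂ (p∩q⊆p B₁ S))) ⟩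
        ∣ (B₂ ∩ S) ∩ B₁ ∣ + ∣ B₁ ─ B₂ ∣        ≡⟨ cong (∣ (B₂ ∩ S) ∩ B₁ ∣ +_) (∣B₁─B₂∣≡∣B₂─B₁∣ b₁ b₂) ⟩
        ∣ (B₂ ∩ S) ∩ B₁ ∣ + ∣ B₂ ─ B₁ ∣        ≤⟨ +-mono-≤ (≤-reflexive refl) (p⊆q⇒∣p∣≤∣q∣ B₂─B₁⊆) ⟩
        ∣ (B₂ ∩ S) ∩ B₁ ∣ + ∣ (B₂ ∩ S) ─ B₁ ∣ ≡⟨ sym (∣p∣≡∣p∩q∣+∣p─q∣ (B₂ ∩ S) B₁) ⟩
        ∣ B₂ ∩ S ∣                             ≡⟨ cong ∣_∣ (maxIndep-∩ max₂ (B₂ , b₂ , λ {_} m → m) K₂⊆B₂) ⟩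
        ∣ K₂ ∣                                 ∎
        where
          open ≤-Reasoning
          swap-∩ : (B₁ ∩ S) ∩ B₂ ⊆ (B₂ ∩ S) ∩ B₁
          swap-∩ m = let x∈B₁∩S , x∈B₂ = x∈p∩q⁻ (B₁ ∩ S) B₂ m ; x∈B₁ , x∈S = x∈p∩q⁻ B₁ S x∈B₁∩S
                     in x∈p∩q⁺ (x∈p∩q⁺ (x∈B₂ , x∈S) , x∈B₁)
          B₂─B₁⊆ : B₂ ─ B₁ ⊆ (B₂ ∩ S) ─ B₁
          B₂─B₁⊆ {x} m with x∈p─q⁻ B₂ B₁ m | x ∈? S
          ... | x∈B₂ , x∉B₁ | yes x∈S = x∈p∧x∉q⇒x∈p─q (x∈p∩q⁺ (x∈B₂ , x∈S)) x∉B₁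
          ... | x∈B₂ , x∉B₁ | no x∉S  = ⊥-elim (∄ (x , x∈B₂ , x∉B₁ , x∉S))

  maxIndep-card : ∀ {S K₁ K₂} → MaxIndep S K₁ → MaxIndep S K₂ → ∣ K₁ ∣ ≡ ∣ K₂ ∣
  maxIndep-card max₁ max₂ = ≤-antisym (maxIndep-card-≤ max₁ max₂) (maxIndep-card-≤ max₂ max₁)

  -- Both I ∪ J′ and a maximal extension K of J are maximal independent in I ∪ C, and K ⊆ I ∪ J.
  indep-∪-maxIndep : ∀ {C J J′ I} → MaxIndep C J → MaxIndep C J′ → (∀ {x} → x ∈ I → x ∉ C) →
                     Indep (I ∪ J′) → Indep (I ∪ J)
  indep-∪-maxIndep {C} {J} {J′} {I} maxJ maxJ′@(J′⊆C , _ , _) I∩C≡∅ iI∪J′ with extend (proj₁ (proj₂ maxJ)) (λ m → q⊆p∪q I C (proj₁ maxJ m))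
  ... | K , maxK@(K⊆S , iK , _) , J⊆K = subst Indep (⊆∧∣∣≤⇒≡ K⊆I∪J ∣I∪J∣≤∣K∣) iK
    where
      S = I ∪ C
      into-I∪ : ∀ {X Z} → Indep Z → X ⊆ Z → MaxIndep C X → Z ⊆ S → Z ⊆ I ∪ X
      into-I∪ {X} {Z} iZ X⊆Z maxX Z⊆S {x} x∈Z with x∈p∪q⁻ I C (Z⊆S x∈Z)
      ... | inj₁ x∈I = p⊆p∪q X x∈I
      ... | inj₂ x∈C = q⊆p∪q I X (subst (x ∈_) (maxIndep-∩ maxX iZ X⊆Z) (x∈p∩q⁺ (x∈Z , x∈C)))
      I∪J′⊆S : I ∪ J′ ⊆ S
      I∪J′⊆S m with x∈p∪q⁻ I J′ m
      ... | inj₁ x∈I  = p⊆p∪q C x∈I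
      ... | inj₂ x∈J′ = q⊆p∪q I C (J′⊆C x∈J′)
      maxI∪J′ : MaxIndep S (I ∪ J′)
      maxI∪J′ = I∪J′⊆S , iI∪J′ , λ K′ K′⊆S iK′ I∪J′⊆K′ →
        ⊆-antisym (into-I∪ iK′ (λ m → I∪J′⊆K′ (q⊆p∪q I J′ m)) maxJ′ K′⊆S) I∪J′⊆K′
      K⊆I∪J : K ⊆ I ∪ J
      K⊆I∪J = into-I∪ iK J⊆K maxJ K⊆S
      I∩J′≡⊥ : I ∩ J′ ≡ ⊥
      I∩J′≡⊥ = ⊆-antisym (λ m → let x∈I , x∈J′ = x∈p∩q⁻ I J′ m in ⊥-elim (I∩C≡∅ x∈I (J′⊆C x∈J′))) (λ m → ⊥-elim (∉⊥ m))
      ∣I∪J∣≤∣K∣ : ∣ I ∪ J ∣ ≤ ∣ K ∣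
      ∣I∪J∣≤∣K∣ = begin
        ∣ I ∪ J ∣                     ≤⟨ m≤m+n ∣ I ∪ J ∣ ∣ I ∩ J ∣ ⟩
        ∣ I ∪ J ∣ + ∣ I ∩ J ∣         ≡⟨ ∣p∪q∣+∣p∩q∣≡∣p∣+∣q∣ I J ⟩
        ∣ I ∣ + ∣ J ∣                 ≡⟨ cong (∣ I ∣ +_) (maxIndep-card maxJ maxJ′) ⟩
        ∣ I ∣ + ∣ J′ ∣                ≡⟨ sym (∣p∪q∣+∣p∩q∣≡∣p∣+∣q∣ I J′) ⟩
        ∣ I ∪ J′ ∣ + ∣ I ∩ J′ ∣       ≡⟨ cong (λ Z → ∣ I ∪ J′ ∣ + ∣ Z ∣) I∩J′≡⊥ ⟩
        ∣ I ∪ J′ ∣ + ∣ ⊥ {n} ∣        ≡⟨ cong (∣ I ∪ J′ ∣ +_) (∣⊥∣≡0 n) ⟩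
        ∣ I ∪ J′ ∣ + 0                ≡⟨ +-identityʳ _ ⟩
        ∣ I ∪ J′ ∣                    ≡⟨ maxIndep-card maxI∪J′ maxK ⟩
        ∣ K ∣                         ∎
        where open ≤-Reasoning

  -- the bases of (M | S) / A, for A independent in S
  MinorBases : Subset n → Subset n → SetSystem n
  MinorBases A S Y = ∃ λ K → A ⊆ K × MaxIndep S K × Y ≡ K ─ A

  minorBases-⊥ : MinorBases ⊥ E ≐ IsBasis
  minorBases-⊥ Y = mk⇔
    (λ (K , _ , maxK , Y≡K─⊥) → subst IsBasis (sym (trans Y≡K─⊥ (p─⊥≡p K))) (from isBasis⇔maxIndep maxK))
    (λ b → Y , (λ {_} m → ⊥-elim (∉⊥ m)) , to isBasis⇔maxIndep b , sym (p─⊥≡p Y))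

  minorBases-/ˢ : ∀ {A S x} → x ∉ A → MinorBases A S /ˢ x ≐ MinorBases (A ∪ ⁅ x ⁆) S
  minorBases-/ˢ {A} {S} {x} x∉A Y = mk⇔
    (λ (x∉Y , K , A⊆K , maxK , Y∪x≡K─A) →
      let x∈K─A = subst (x ∈_) Y∪x≡K─A (q⊆p∪q Y ⁅ x ⁆ (x∈⁅x⁆ x)) in
      K , ∪⁅x⁆-⊆ A⊆K (proj₁ (x∈p─q⁻ K A x∈K─A)) , maxK ,
      trans (sym (p∪x─x≡p x∉Y)) (trans (cong (_─ ⁅ x ⁆) Y∪x≡K─A) (p─q─r≡p─q∪r K A ⁅ x ⁆)))
    (λ (K , A∪x⊆K , maxK , Y≡K─A∪x) →
      let Y≡K─A─x = trans Y≡K─A∪x (sym (p─q─r≡p─q∪r K A ⁅ x ⁆)) in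
      subst (x ∉_) (sym Y≡K─A─x) (x∉p─x (K ─ A) x) , K , (λ m → A∪x⊆K (p⊆p∪q ⁅ x ⁆ m)) , maxK ,
      trans (cong (_∪ ⁅ x ⁆) Y≡K─A─x)
            (p─x∪x≡p (x∈p∧x∉q⇒x∈p─q (A∪x⊆K (q⊆p∪q A ⁅ x ⁆ (x∈⁅x⁆ x))) x∉A)))

  -- Some maximal K ⊇ A in S avoids q, so all maximal sets of S ─ ⁅ q ⁆ have the size of those of S.
  minorBases-∖ˢ : ∀ {A S q} → q ∉ A → ∃ (MinorBases A S ∖ˢ q) → MinorBases A S ∖ˢ q ≐ MinorBases A (S ─ ⁅ q ⁆)
  minorBases-∖ˢ {A} {S} {q} q∉A (Y₀ , (K₀ , A⊆K₀ , maxK₀ , Y₀≡K₀─A) , q∉Y₀) Y = mk⇔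
    (λ ((K , A⊆K , maxK , Y≡K─A) , q∉Y) →
      K , A⊆K , maxIndep-restrict S─q⊆S (avoiding maxK (q∉K Y≡K─A q∉Y)) maxK , Y≡K─A)
    (λ (K , A⊆K , maxK@(K⊆S─q , iK , maximal) , Y≡K─A) →
      (K , A⊆K , ((λ m → S─q⊆S (K⊆S─q m)) , iK , maximal-in-S maxK) , Y≡K─A) ,
      λ q∈Y → proj₂ (x∈p─q⁻ S ⁅ q ⁆ (K⊆S─q (proj₁ (x∈p─q⁻ K A (subst (q ∈_) Y≡K─A q∈Y))))) (x∈⁅x⁆ q))
    where
      S─q⊆S = p─q⊆p S ⁅ q ⁆
      q∉K : ∀ {K Y} → Y ≡ K ─ A → q ∉ Y → q ∉ K
      q∉K Y≡K─A q∉Y q∈K = q∉Y (subst (q ∈_) (sym Y≡K─A) (x∈p∧x∉q⇒x∈p─q q∈K q∉A))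
      avoiding : ∀ {K} → MaxIndep S K → q ∉ K → K ⊆ S ─ ⁅ q ⁆
      avoiding (K⊆S , _) q∉K m = x∈p∧x≢y⇒x∈p-y (K⊆S m) (∈∧∉⇒≢ m q∉K)
      maxK₀′ : MaxIndep (S ─ ⁅ q ⁆) K₀
      maxK₀′ = maxIndep-restrict S─q⊆S (avoiding maxK₀ (q∉K Y₀≡K₀─A q∉Y₀)) maxK₀
      maximal-in-S : ∀ {K} → MaxIndep (S ─ ⁅ q ⁆) K → ∀ K′ → K′ ⊆ S → Indep K′ → K ⊆ K′ → K′ ≡ K
      maximal-in-S {K} maxK K′ K′⊆S iK′ K⊆K′ with extend iK′ K′⊆S
      ... | K″ , maxK″ , K′⊆K″ = ⊆-antisym (λ m → subst (_ ∈_) (sym K≡K″) (K′⊆K″ m)) K⊆K′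
        where
          K≡K″ : K ≡ K″
          K≡K″ = ⊆∧∣∣≤⇒≡ (λ m → K′⊆K″ (K⊆K′ m))
                   (≤-reflexive (trans (maxIndep-card maxK″ maxK₀) (maxIndep-card maxK₀′ maxK)))

  minorBases-coloop : ∀ {A S q} → q ∉ A → (∀ K → A ⊆ K → MaxIndep S K → q ∈ K) →
                      MinorBases A S /ˢ q ≐ MinorBases A (S ─ ⁅ q ⁆)
  minorBases-coloop {A} {S} {q} q∉A coloop Y = mk⇔
    (λ (q∉Y , K , A⊆K , maxK@(K⊆S , iK , _) , Y∪q≡K─A) →
      K ─ ⁅ q ⁆ , (λ m → x∈p∧x≢y⇒x∈p-y (A⊆K m) (∈∧∉⇒≢ m q∉A)) ,
      (─-monoˡ ⁅ q ⁆ K⊆S , indep-⊆ (p─q⊆p K ⁅ q ⁆) iK , maximal A⊆K maxK) ,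
      trans (sym (p∪x─x≡p q∉Y)) (trans (cong (_─ ⁅ q ⁆) Y∪q≡K─A) (p─q─r≡p─r─q K A ⁅ q ⁆)))
    (λ (K , A⊆K , maxK@(K⊆S─q , iK , maximalK) , Y≡K─A) →
      let K″ , maxK″@(K″⊆S , iK″ , _) , K⊆K″ = extend iK (λ m → p─q⊆p S ⁅ q ⁆ (K⊆S─q m))
          q∈K″ = coloop K″ (λ m → K⊆K″ (A⊆K m)) maxK″
          K″─q≡K = maximalK (K″ ─ ⁅ q ⁆) (─-monoˡ ⁅ q ⁆ K″⊆S) (indep-⊆ (p─q⊆p K″ ⁅ q ⁆) iK″)
                     (λ m → x∈p∧x≢y⇒x∈p-y (K⊆K″ m) (λ { refl → proj₂ (x∈p─q⁻ S ⁅ q ⁆ (K⊆S─q m)) (x∈⁅x⁆ q) }))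
          Y≡K″─A─q = trans Y≡K─A (trans (cong (_─ A) (sym K″─q≡K)) (p─q─r≡p─r─q K″ ⁅ q ⁆ A))
      in subst (q ∉_) (sym Y≡K″─A─q) (x∉p─x (K″ ─ A) q) ,
         K″ , (λ m → K⊆K″ (A⊆K m)) , maxK″ ,
         trans (cong (_∪ ⁅ q ⁆) Y≡K″─A─q) (p─x∪x≡p (x∈p∧x∉q⇒x∈p─q q∈K″ q∉A)))
    where
      maximal : ∀ {K} → A ⊆ K → MaxIndep S K → ∀ K′ → K′ ⊆ S ─ ⁅ q ⁆ → Indep K′ → K ─ ⁅ q ⁆ ⊆ K′ → K′ ≡ K ─ ⁅ q ⁆
      maximal {K} A⊆K maxK K′ K′⊆S─q iK′ K─q⊆K′ with extend iK′ (λ m → p─q⊆p S ⁅ q ⁆ (K′⊆S─q m))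
      ... | K″ , maxK″ , K′⊆K″ = ⊆-antisym K′⊆K─q K─q⊆K′
        where
          A⊆K─q : A ⊆ K ─ ⁅ q ⁆
          A⊆K─q m = x∈p∧x≢y⇒x∈p-y (A⊆K m) (∈∧∉⇒≢ m q∉A)
          K⊆K″ : K ⊆ K″
          K⊆K″ {x} x∈K with x ≟ᶠ q
          ... | yes refl = coloop K″ (λ m → K′⊆K″ (K─q⊆K′ (A⊆K─q m))) maxK″
          ... | no x≢q   = K′⊆K″ (K─q⊆K′ (x∈p∧x≢y⇒x∈p-y x∈K x≢q))
          K≡K″ : K ≡ K″
          K≡K″ = ⊆∧∣∣≤⇒≡ K⊆K″ (≤-reflexive (maxIndep-card maxK″ maxK))
          K′⊆K─q : K′ ⊆ K ─ ⁅ q ⁆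
          K′⊆K─q m = x∈p∧x∉q⇒x∈p─q (subst (_ ∈_) (sym K≡K″) (K′⊆K″ m)) (proj₂ (x∈p─q⁻ S ⁅ q ⁆ (K′⊆S─q m)))

-- Minors of delta-graphic matroids

module _ {n : ℕ} (M : Matroid n) (deltaGraphic-M : DeltaGraphic (Matroid.E M) (Matroid.IsBasis M)) where
  open Matroid M
  open MatroidTheory M (deltaGraphic⇒decidable deltaGraphic-M)

  deltaGraphic-minorBases-/ : ∀ {E₀ A S x} → x ∉ A → Indep (A ∪ ⁅ x ⁆) → A ∪ ⁅ x ⁆ ⊆ S →
                              DeltaGraphic E₀ (MinorBases A S) → DeltaGraphic (E₀ ─ ⁅ x ⁆) (MinorBases (A ∪ ⁅ x ⁆) S)
  deltaGraphic-minorBases-/ {A = A} {S} {x} x∉A iA∪x A∪x⊆S d =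
    let K , maxK , A∪x⊆K = extend iA∪x A∪x⊆S
    in DeltaGraphic-cong (minorBases-/ˢ x∉A) (DeltaGraphic-/ˢ d (_ , from (minorBases-/ˢ x∉A _) (K , A∪x⊆K , maxK , refl)))

  deltaGraphic-minorBases-∖ : ∀ {E₀ J S q} → Indep J → J ⊆ S → q ∉ J →
                              DeltaGraphic E₀ (MinorBases J S) → DeltaGraphic (E₀ ─ ⁅ q ⁆) (MinorBases J (S ─ ⁅ q ⁆))
  deltaGraphic-minorBases-∖ {J = J} {S} {q} iJ J⊆S q∉J d with anySubset? (λ Y → deltaGraphic⇒decidable d Y ×-dec ¬? (q ∈? Y))
  ... | yes avoided = DeltaGraphic-cong (minorBases-∖ˢ q∉J avoided) (DeltaGraphic-∖ˢ d avoided)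
  ... | no unavoidable =
    let K , maxK , J⊆K = extend iJ J⊆S
    in DeltaGraphic-cong (minorBases-coloop q∉J coloop)
         (DeltaGraphic-/ˢ d (∈⇒∃-/ˢ {P = MinorBases J S} (K , J⊆K , maxK , refl) (x∈p∧x∉q⇒x∈p─q (coloop K J⊆K maxK) q∉J)))
    where
      coloop : ∀ K → J ⊆ K → MaxIndep S K → q ∈ K
      coloop K J⊆K maxK with q ∈? K
      ... | yes q∈K = q∈K
      ... | no  q∉K = ⊥-elim (unavoidable (K ─ J , (K , J⊆K , maxK , refl) , λ m → q∉K (proj₁ (x∈p─q⁻ K J m))))

  deltaGraphic-contract : ∀ {J} → Indep J → DeltaGraphic (E ─ J) (MinorBases J E)
  deltaGraphic-contract {J} iJ@(B , b , J⊆B) = subset-induction J (λ A → DeltaGraphic (E ─ A) (MinorBases A E))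
    (subst (λ E₀ → DeltaGraphic E₀ (MinorBases ⊥ E)) (sym (p─⊥≡p E)) (DeltaGraphic-cong (⇔-sym ∘ minorBases-⊥) deltaGraphic-M))
    λ {A} {x} A⊆J x∈J x∉A d → subst (λ E₀ → DeltaGraphic E₀ (MinorBases (A ∪ ⁅ x ⁆) E)) (p─q─r≡p─q∪r E A ⁅ x ⁆)
      (deltaGraphic-minorBases-/ x∉A (indep-⊆ (∪⁅x⁆-⊆ A⊆J x∈J) iJ) (λ m → basis⊆E b (J⊆B (∪⁅x⁆-⊆ A⊆J x∈J m))) d)

  deltaGraphic-delete : ∀ {J Q} → Indep J → J ⊆ E ─ Q → DeltaGraphic ((E ─ J) ─ Q) (MinorBases J (E ─ Q))
  deltaGraphic-delete {J} {Q} iJ J⊆E─Q = subset-induction Q (λ A → DeltaGraphic ((E ─ J) ─ A) (MinorBases J (E ─ A)))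
    (subst₂ (λ E₀ S → DeltaGraphic E₀ (MinorBases J S)) (sym (p─⊥≡p (E ─ J))) (sym (p─⊥≡p E)) (deltaGraphic-contract iJ))
    λ {A} {q} A⊆Q q∈Q q∉A d → subst₂ (λ E₀ S → DeltaGraphic E₀ (MinorBases J S)) (p─q─r≡p─q∪r (E ─ J) A ⁅ q ⁆) (p─q─r≡p─q∪r E A ⁅ q ⁆)
      (deltaGraphic-minorBases-∖ iJ (J⊆E─A A⊆Q) (λ q∈J → proj₂ (x∈p─q⁻ E Q (J⊆E─Q q∈J)) q∈Q) d)
    where
      J⊆E─A : ∀ {A} → A ⊆ Q → J ⊆ E ─ A
      J⊆E─A A⊆Q m = let x∈E , x∉Q = x∈p─q⁻ E Q (J⊆E─Q m) in x∈p∧x∉q⇒x∈p─q x∈E (λ x∈A → x∉Q (A⊆Q x∈A))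

  module _ {C D J : Subset n} (C⊆E : C ⊆ E) (C∩D≡⊥ : C ∩ D ≡ ⊥) (maxJ : MaxIndep C J) where
    private
      Q = (C ─ J) ∪ D
      J⊆C = proj₁ maxJ
      iJ = proj₁ (proj₂ maxJ)

      E′∌C : ∀ {x} → x ∈ minorE M C D → x ∉ C
      E′∌C m x∈C = proj₂ (x∈p─q⁻ E (C ∪ D) m) (p⊆p∪q D x∈C)

      E′∌J : ∀ {x} → x ∈ minorE M C D → x ∉ J
      E′∌J m x∈J = E′∌C m (J⊆C x∈J)

      E′⊆E─Q : minorE M C D ⊆ E ─ Q
      E′⊆E─Q {x} m = let x∈E , x∉C∪D = x∈p─q⁻ E (C ∪ D) m in x∈p∧x∉q⇒x∈p─q x∈E λ x∈Q →
        x∉C∪D ([ (λ x∈C─J → p⊆p∪q D (proj₁ (x∈p─q⁻ C J x∈C─J))) , q⊆p∪q C D ] (x∈p∪q⁻ (C ─ J) D x∈Q))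

      E─Q∖J⊆E′ : ∀ {x} → x ∈ E ─ Q → x ∉ J → x ∈ minorE M C D
      E─Q∖J⊆E′ {x} m x∉J = let x∈E , x∉Q = x∈p─q⁻ E Q m in x∈p∧x∉q⇒x∈p─q x∈E λ x∈C∪D →
        x∉Q ([ (λ x∈C → p⊆p∪q D (x∈p∧x∉q⇒x∈p─q x∈C x∉J)) , q⊆p∪q (C ─ J) D ] (x∈p∪q⁻ C D x∈C∪D))

    J⊆E─Q : J ⊆ E ─ Q
    J⊆E─Q {x} x∈J = x∈p∧x∉q⇒x∈p─q (C⊆E (J⊆C x∈J)) λ x∈Q →
      [ (λ x∈C─J → proj₂ (x∈p─q⁻ C J x∈C─J) x∈J) , (λ x∈D → ∉⊥ (subst (x ∈_) C∩D≡⊥ (x∈p∩q⁺ (J⊆C x∈J , x∈D)))) ]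
        (x∈p∪q⁻ (C ─ J) D x∈Q)

    ground-minor : (E ─ J) ─ Q ≡ minorE M C D
    ground-minor = ⊆-antisym
      (λ m → let x∈E─J , x∉Q = x∈p─q⁻ (E ─ J) Q m ; x∈E , x∉J = x∈p─q⁻ E J x∈E─J
             in E─Q∖J⊆E′ (x∈p∧x∉q⇒x∈p─q x∈E x∉Q) x∉J)
      (λ m → let x∈E , x∉Q = x∈p─q⁻ E Q (E′⊆E─Q m) in x∈p∧x∉q⇒x∈p─q (x∈p∧x∉q⇒x∈p─q x∈E (E′∌J m)) x∉Q)

    minorBases⇒minorBasis : ∀ {Y} → MinorBases J (E ─ Q) Y → minorBasis M C D Y
    minorBases⇒minorBasis {Y} (K , J⊆K , (K⊆E─Q , iK , maximalK) , Y≡K─J) = (Y⊆E′ , J , maxJ , indep-⊆ Y∪J⊆K iK) , maximalY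
      where
        Y⊆E′ : Y ⊆ minorE M C D
        Y⊆E′ m = let x∈K , x∉J = x∈p─q⁻ K J (subst (_ ∈_) Y≡K─J m) in E─Q∖J⊆E′ (K⊆E─Q x∈K) x∉J
        Y∪J⊆K : Y ∪ J ⊆ K
        Y∪J⊆K m = [ (λ x∈Y → proj₁ (x∈p─q⁻ K J (subst (_ ∈_) Y≡K─J x∈Y))) , J⊆K ] (x∈p∪q⁻ Y J m)
        maximalY : ∀ I → minorIndep M C D I → Y ⊆ I → I ≡ Y
        maximalY I (I⊆E′ , J′ , maxJ′ , iI∪J′) Y⊆I = ⊆-antisym I⊆Y Y⊆I
          where
            I∪J≡K : I ∪ J ≡ K
            I∪J≡K = maximalK (I ∪ J)
              (λ m → [ (λ x∈I → E′⊆E─Q (I⊆E′ x∈I)) , J⊆E─Q ] (x∈p∪q⁻ I J m))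
              (indep-∪-maxIndep maxJ maxJ′ (λ x∈I → E′∌C (I⊆E′ x∈I)) iI∪J′)
              (⊆-∪-by (λ x∈K x∉J → Y⊆I (subst (_ ∈_) (sym Y≡K─J) (x∈p∧x∉q⇒x∈p─q x∈K x∉J))))
            I⊆Y : I ⊆ Y
            I⊆Y m = subst (_ ∈_) (sym Y≡K─J) (x∈p∧x∉q⇒x∈p─q (subst (_ ∈_) I∪J≡K (p⊆p∪q J m)) (E′∌J (I⊆E′ m)))

    minorBasis⇒minorBases : ∀ {Y} → minorBasis M C D Y → MinorBases J (E ─ Q) Y
    minorBasis⇒minorBases {Y} ((Y⊆E′ , J′ , maxJ′ , iY∪J′) , maximalY) =
      Y ∪ J , q⊆p∪q Y J , (Y∪J⊆E─Q , iY∪J , maximal) , sym (p∪q─q≡p (λ x∈Y → E′∌J (Y⊆E′ x∈Y)))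
      where
        Y∪J⊆E─Q : Y ∪ J ⊆ E ─ Q
        Y∪J⊆E─Q m = [ (λ x∈Y → E′⊆E─Q (Y⊆E′ x∈Y)) , J⊆E─Q ] (x∈p∪q⁻ Y J m)
        iY∪J : Indep (Y ∪ J)
        iY∪J = indep-∪-maxIndep maxJ maxJ′ (λ x∈Y → E′∌C (Y⊆E′ x∈Y)) iY∪J′
        maximal : ∀ K′ → K′ ⊆ E ─ Q → Indep K′ → Y ∪ J ⊆ K′ → K′ ≡ Y ∪ J
        maximal K′ K′⊆E─Q iK′ Y∪J⊆K′ = ⊆-antisym (⊆-∪-by (λ x∈K′ x∉J → subst (_ ∈_) I≡Y (x∈p∧x∉q⇒x∈p─q x∈K′ x∉J))) Y∪J⊆K′
          where
            I = K′ ─ J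
            I≡Y : I ≡ Y
            I≡Y = maximalY I
              ( (λ m → let x∈K′ , x∉J = x∈p─q⁻ K′ J m in E─Q∖J⊆E′ (K′⊆E─Q x∈K′) x∉J) , J , maxJ
              , indep-⊆ (λ m → [ (λ x∈I → proj₁ (x∈p─q⁻ K′ J x∈I)) , (λ x∈J → Y∪J⊆K′ (q⊆p∪q Y J x∈J)) ] (x∈p∪q⁻ I J m)) iK′)
              (λ m → x∈p∧x∉q⇒x∈p─q (Y∪J⊆K′ (p⊆p∪q J m)) (E′∌J (Y⊆E′ m)))

    deltaGraphic-minor : DeltaGraphic (minorE M C D) (minorBasis M C D)
    deltaGraphic-minor = subst (λ E′ → DeltaGraphic E′ (minorBasis M C D)) ground-minor
      (DeltaGraphic-cong (λ _ → mk⇔ minorBases⇒minorBasis minorBasis⇒minorBases) (deltaGraphic-delete iJ J⊆E─Q))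

lemma3p2 : ∀ {n} (M : Matroid n) (C D : Subset n) →
    C ⊆ Matroid.E M → D ⊆ Matroid.E M → C ∩ D ≡ ⊥ →
    DeltaGraphic (Matroid.E M) (Matroid.IsBasis M) →
    DeltaGraphic (minorE M C D) (minorBasis M C D)
lemma3p2 M C D C⊆E _ C∩D≡⊥ deltaGraphic-M =
  let J , maxJ , _ = extend {S = C} indep-⊥ (λ m → ⊥-elim (∉⊥ m))
  in deltaGraphic-minor M deltaGraphic-M C⊆E C∩D≡⊥ maxJ
  where open MatroidTheory M (deltaGraphic⇒decidable deltaGraphic-M)
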